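{- (1) Let $X$ be a connected graph. Then $\gamma(X)$ is connected if and only if $X$ is neither a cycle graph nor a path graph. Moreover, $\gamma(X)$ cannot be a cycle graph unless $X=K_{1,3}$. (2) Let $X$ be a graph such that $\gamma(X)$ is connected. Then $\gamma(X)$ has a cut edge if and only if $X$ contains a pendant vertex (a vertex of degree one) which is adjacent to a vertex of degree two. (3) Let $X$ be a connected graph. Then $X$ is bipartite if and only if $\gamma(X)$ is bipartite.
   Context: All graphs are finite, without loops or multiple edges. For a graph $X$ with $m$ edges, orient each edge arbitrarily and label the oriented edges $e_1,\dots,e_m$; put $e_{m+i}=e_i^{ -1}$ ($e_i$ reversed), and write $s(e),t(e)$ for the starting and terminal vertex of an oriented edge $e$. The edge adjacency matrix $M$ is the $2m\times 2m$ matrix with $M_{ij}=1$ if $t(e_i)=s(e_j)$ and $s(e_i)\neq t(e_j)$, and $0$ otherwise. The symmetric edge graph $\gamma(X)$ is the graph on the $2m$ vertices $e_1,\dots,e_{2m}$ with adjacency matrix $M+M^T$. Equivalently, the vertices of $\gamma(X)$ are the ordered pairs $(u,v)$ with $uv\in E(X)$, and $(u,v)\sim(x,y)$ iff ($v=x$ and $y\neq u$) or ($y=u$ and $x\neq v$). $K_{1,3}$ denotes the star with three leaves. -}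

module Defs where

open import Data.Nat using (ℕ; zero; suc; _+_; _≤_)
import Data.Nat as ℕ
open import Data.Fin using (Fin; toℕ)
open import Data.Fin.Properties using (_≟_)
open import Data.Bool using (Bool; true; false; _∧_; _∨_; not; T; if_then_else_)
open import Data.List using (List; map)
open import Data.Nat.ListAction using (sum)
open import Data.List using () renaming (allFin to allFinL)
open import Data.Product using (Σ; ∃; _×_; _,_; proj₁; proj₂)
open import Data.Sum using (_⊎_)
open import Relation.Nullary using (¬_; ⌊_⌋)
open import Relation.Binary.PropositionalEquality using (_≡_; _≢_)
open import Relation.Binary.Construct.Closure.ReflexiveTransitive using (Star)
open import Function.Bundles using (_↔_; Inverse)

BRel : Set → Set
BRel V = V → V → Bool

record Graph (n : ℕ) : Set where
  field
    adj      : BRel (Fin n)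
    adj-sym  : ∀ u v → adj u v ≡ adj v u
    loopless : ∀ u → adj u u ≡ false
open Graph public

Reach : {V : Set} → BRel V → V → V → Set
Reach R = Star (λ a b → T (R a b))

Connected : {V : Set} → BRel V → Set
Connected {V} R = V × (∀ a b → Reach R a b)

Bipartite : {V : Set} → BRel V → Set
Bipartite {V} R = Σ (V → Bool) λ c → ∀ a b → T (R a b) → c a ≢ c b

Isomorphic : {V W : Set} → BRel V → BRel W → Set
Isomorphic {V} {W} R S =
  Σ (V ↔ W) λ f → ∀ a b → R a b ≡ S (Inverse.to f a) (Inverse.to f b)

ReachAvoiding : {V : Set} → BRel V → V → V → V → V → Set
ReachAvoiding R a b =
  Star (λ x y → T (R x y) × ¬ ((x ≡ a × y ≡ b) ⊎ (x ≡ b × y ≡ a)))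

HasCutEdge : {V : Set} → BRel V → Set
HasCutEdge {V} R = Σ V λ a → Σ V λ b → T (R a b) × ¬ ReachAvoiding R a b a b

pathAdj : (k : ℕ) → BRel (Fin k)
pathAdj k i j = ⌊ toℕ j ℕ.≟ suc (toℕ i) ⌋ ∨ ⌊ toℕ i ℕ.≟ suc (toℕ j) ⌋

cycleAdj : (k : ℕ) → BRel (Fin k)
cycleAdj k i j = pathAdj k i j
  ∨ (⌊ toℕ i ℕ.≟ 0 ⌋ ∧ ⌊ toℕ j ℕ.≟ k ℕ.∸ 1 ⌋)
  ∨ (⌊ toℕ j ℕ.≟ 0 ⌋ ∧ ⌊ toℕ i ℕ.≟ k ℕ.∸ 1 ⌋)

starAdj : BRel (Fin 4)
starAdj i j = (⌊ toℕ i ℕ.≟ 0 ⌋ ∧ not ⌊ toℕ j ℕ.≟ 0 ⌋)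
            ∨ (⌊ toℕ j ℕ.≟ 0 ⌋ ∧ not ⌊ toℕ i ℕ.≟ 0 ⌋)

IsPathGraph : {V : Set} → BRel V → Set
IsPathGraph R = Σ ℕ λ k → 1 ≤ k × Isomorphic R (pathAdj k)

IsCycleGraph : {V : Set} → BRel V → Set
IsCycleGraph R = Σ ℕ λ k → 3 ≤ k × Isomorphic R (cycleAdj k)

IsK13 : {V : Set} → BRel V → Set
IsK13 R = Isomorphic R starAdj

boolToℕ : Bool → ℕ
boolToℕ true  = 1
boolToℕ false = 0

degree : {n : ℕ} → Graph n → Fin n → ℕ
degree {n} X v = sum (map (λ u → boolToℕ (adj X v u)) (allFinL n))

HasPendantNextToDeg2 : {n : ℕ} → Graph n → Set
HasPendantNextToDeg2 {n} X =
  Σ (Fin n) λ u → Σ (Fin n) λ v →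
    T (adj X u v) × degree X u ≡ 1 × degree X v ≡ 2

DirEdge : {n : ℕ} → Graph n → Set
DirEdge {n} X = Σ (Fin n × Fin n) λ p → T (adj X (proj₁ p) (proj₂ p))

γ : {n : ℕ} → (X : Graph n) → BRel (DirEdge X)
γ X ((u , v) , _) ((x , y) , _) =
    (⌊ v ≟ x ⌋ ∧ not ⌊ y ≟ u ⌋) ∨ (⌊ y ≟ u ⌋ ∧ not ⌊ x ≟ v ⌋)

module Submission where

-- (1) Paths and cycles admit an orientation in which every vertex has in- and out-degree at most
-- one; arcs agreeing with it are γ-adjacent only to such arcs, so an arc and its reverse lie in
-- different components of γ(X). Any other connected graph has a vertex z with three neighbours:
-- walking around z reaches every arc at z, and this spreads along the edges of X. Following a
-- walk that never turns back shows that a connected graph of maximum degree two is a path or a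
-- cycle. If γ(X) is a cycle it is connected and has maximum degree two, which pins X down to a
-- claw with nothing attached.
-- (2) At a pendant vertex u next to v of degree two, (v , u) has the single γ-neighbour (w , v).
-- Conversely, remove a bridge (u , v) — (v , w) of γ(X), record on which side every arc lies, and
-- call an edge flipped when its two arcs lie on different sides. Without a pendant vertex next to
-- a vertex of degree two, every vertex other than v is incident with an even number of flipped
-- edges while v is incident with exactly one, which is impossible.
-- (3) A colouring of X pulls back to γ(X) along the source map. Conversely the colour of a proper
-- colouring of γ(X) alternates along non-backtracking walks, which makes every closed walk of X
-- even; the parity of walks from a root then colours X.

open import Defs
open import Data.Nat using (ℕ)
open import Data.Product using (_×_)
open import Function.Bundles using (_⇔_)
open import Relation.Nullary using (¬_)
open import Data.Sum using (_⊎_)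

open import Algebra.Bundles using (CommutativeMonoid; CommutativeRing)
open import Data.Bool using (Bool; true; false; not; _xor_; _∧_; T; if_then_else_)
open import Data.Bool.Properties
  using (T?; T-irrelevant; T-∨; T-∧; ¬-not; not-involutive; not-distribˡ-xor; not-distribʳ-xor;
         xor-identityʳ; xor-inverseʳ; xor-same; xor-comm; xor-∧-commutativeRing)
open import Data.Empty using (⊥; ⊥-elim)
open import Data.Fin as Fin using (Fin; toℕ; fromℕ<; punchIn; punchOut)
open import Data.Fin.Patterns using (0F; 1F; 2F; 3F)
open import Data.Fin.Properties
  using (_≟_; any?; pigeonhole; toℕ-injective; toℕ<n; toℕ-fromℕ<; fromℕ<-toℕ;
         punchInᵢ≢i; punchIn-injective; punchIn-punchOut; punchOut-injective)
import Data.List as List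
open import Data.List.Properties using (map-tabulate)
import Data.Nat as ℕ
open import Data.Nat using (zero; suc; _+_; _≤_; _<_; z≤n; s≤s)
import Data.Nat.ListAction as ListAction
open import Data.Nat.Properties
  using (suc-injective; 1+n≢0; n≢0⇒n>0; +-comm; m≢1+m+n; ≤-refl; ≤-pred; <-irrefl; <-cmp; <⇒≢;
         n<1+n; m<n⇒m<1+n; m<1+n⇒m<n∨m≡n; m≤m+n; m+n≤o⇒m≤o; +-monoʳ-≤; +-0-commutativeMonoid)
import Data.Product
open import Data.Product using (Σ; _,_; proj₁; proj₂)
open import Data.Product.Function.NonDependent.Propositional using (_×-⇔_)
import Data.Sum
open import Data.Sum using (inj₁; inj₂; [_,_]; [_,_]′)
open import Data.Sum.Function.Propositional using (_⊎-⇔_)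
open import Data.Unit using (⊤; tt)
open import Function using (_∘_; id)
open import Function.Bundles using (Equivalence; Inverse; Injection; mk⇔; mk↔ₛ′)
open import Function.Properties.Equivalence using () renaming (refl to ⇔-refl; sym to ⇔-sym; trans to ⇔-trans)
open import Function.Properties.Inverse using (↔⇒↣)
open import Level using (0ℓ)
open import Relation.Binary.Construct.Closure.ReflexiveTransitive using (ε; _◅_; _◅◅_; reverse; revApp; gmap)
open import Relation.Binary.Definitions using (tri<; tri≈; tri>)
open import Relation.Binary.PropositionalEquality
  using (_≡_; _≢_; refl; sym; trans; cong; cong₂; subst; subst₂; module ≡-Reasoning)
open import Relation.Nullary using (Dec; yes; no; ⌊_⌋; ¬?; _×-dec_; _⊎-dec_)
open import Relation.Nullary.Decidable using (decidable-stable; toWitness; fromWitness)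

T-ext : ∀ {a b} → (T a ⇔ T b) → a ≡ b
T-ext {true}  {true}  _  = refl
T-ext {true}  {false} ab = ⊥-elim (Equivalence.to ab tt)
T-ext {false} {true}  ab = ⊥-elim (Equivalence.from ab tt)
T-ext {false} {false} _  = refl

T-⌊⌋ : ∀ {P : Set} (p? : Dec P) → T ⌊ p? ⌋ ⇔ P
T-⌊⌋ p? = mk⇔ (toWitness {a? = p?}) (fromWitness {a? = p?})

least : (P : ℕ → Set) → (∀ i → Dec (P i)) → ∀ {k} → P k → Σ ℕ λ j → P j × (∀ i → i < j → ¬ P i)
least P P? {k} pk = [ (λ (j , _ , pj , below) → j , pj , below) , (λ none → ⊥-elim (none k ≤-refl pk)) ]′
                      (search-below (suc k))
  where
  search-below : ∀ k → (Σ ℕ λ j → j < k × P j × (∀ i → i < j → ¬ P i)) ⊎ (∀ i → i < k → ¬ P i)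
  search-below zero = inj₂ (λ _ ())
  search-below (suc k) with search-below k
  ... | inj₁ (j , j<k , pj , below) = inj₁ (j , m<n⇒m<1+n j<k , pj , below)
  ... | inj₂ none-below with P? k
  ...   | yes pk = inj₁ (k , ≤-refl , pk , none-below)
  ...   | no ¬pk = inj₂ λ i i<1+k → [ none-below i , (λ { refl → ¬pk }) ] (m<1+n⇒m<n∨m≡n i<1+k)

module SupportedSum {c ℓ} (M : CommutativeMonoid c ℓ) where
  open CommutativeMonoid M
    using (Carrier; _≈_; _∙_; ∙-congˡ; identityʳ; setoid) renaming (ε to 0#; trans to ≈-trans)
  open import Algebra.Properties.CommutativeMonoid.Sum M
    using (sum; sum-remove; sum-cong-≋; sum-replicate-zero)
  open import Relation.Binary.Reasoning.Setoid setoid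

  sum-zero : ∀ {m} (t : Fin m → Carrier) → (∀ i → t i ≈ 0#) → sum t ≈ 0#
  sum-zero {m} t t≈0 = ≈-trans (sum-cong-≋ t≈0) (sum-replicate-zero m)

  sum-single : ∀ {m} (t : Fin m → Carrier) (i : Fin m) →
               (∀ j → j ≢ i → t j ≈ 0#) → sum t ≈ t i
  sum-single {suc m} t i t≈0 = begin
    sum t                         ≈⟨ sum-remove {i = i} t ⟩
    t i ∙ sum (t ∘ punchIn i)     ≈⟨ ∙-congˡ (sum-zero (t ∘ punchIn i) (λ j → t≈0 _ (punchInᵢ≢i i j))) ⟩
    t i ∙ 0#                      ≈⟨ identityʳ (t i) ⟩
    t i                           ∎

  sum-pair : ∀ {m} (t : Fin m → Carrier) {i j : Fin m} → i ≢ j →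
             (∀ k → k ≢ i → k ≢ j → t k ≈ 0#) → sum t ≈ t i ∙ t j
  sum-pair {suc m} t {i} {j} i≢j t≈0 = begin
    sum t                       ≈⟨ sum-remove {i = i} t ⟩
    t i ∙ sum (t ∘ punchIn i)   ≈⟨ ∙-congˡ (sum-single (t ∘ punchIn i) (punchOut i≢j) rest≈0) ⟩
    t i ∙ t (punchIn i (punchOut i≢j)) ≡⟨ cong (λ k → t i ∙ t k) (punchIn-punchOut i≢j) ⟩
    t i ∙ t j                   ∎
    where
    rest≈0 : ∀ k → k ≢ punchOut i≢j → t (punchIn i k) ≈ 0#
    rest≈0 k k≢j′ = t≈0 (punchIn i k) (punchInᵢ≢i i k)
      (λ eq → k≢j′ (punchIn-injective i k _ (trans eq (sym (punchIn-punchOut i≢j)))))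

module ℕ-Sum where
  open import Algebra.Properties.CommutativeMonoid.Sum +-0-commutativeMonoid public
    using (sum; sum-remove)
  open SupportedSum +-0-commutativeMonoid public

  sum-tabulate : ∀ {m} (t : Fin m → ℕ) → ListAction.sum (List.tabulate t) ≡ sum t
  sum-tabulate {zero}  t = refl
  sum-tabulate {suc m} t = cong (t Fin.zero +_) (sum-tabulate (t ∘ Fin.suc))

  ≤-sum : ∀ {m} (t : Fin m → ℕ) i → t i ≤ sum t
  ≤-sum {suc m} t i = subst (t i ≤_) (sym (sum-remove {i = i} t)) (m≤m+n (t i) _)

  ≤-sum₂ : ∀ {m} (t : Fin m → ℕ) {i j} → i ≢ j → t i + t j ≤ sum t
  ≤-sum₂ {suc m} t {i} {j} i≢j = subst (t i + t j ≤_) (sym (sum-remove {i = i} t))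
    (+-monoʳ-≤ (t i) (subst (_≤ sum (t ∘ punchIn i)) (cong t (punchIn-punchOut i≢j))
                             (≤-sum (t ∘ punchIn i) (punchOut i≢j))))

  ≤-sum₃ : ∀ {m} (t : Fin m → ℕ) {i j k} → i ≢ j → i ≢ k → j ≢ k → t i + (t j + t k) ≤ sum t
  ≤-sum₃ {suc m} t {i} {j} {k} i≢j i≢k j≢k = subst (t i + (t j + t k) ≤_) (sym (sum-remove {i = i} t))
    (+-monoʳ-≤ (t i) (subst₂ (λ x y → t x + t y ≤ sum (t ∘ punchIn i))
                              (punchIn-punchOut i≢j) (punchIn-punchOut i≢k)
                              (≤-sum₂ (t ∘ punchIn i) (j≢k ∘ punchOut-injective i≢j i≢k))))

module ⊕-Sum where
  ⊕-commutativeMonoid : CommutativeMonoid 0ℓ 0ℓ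
  ⊕-commutativeMonoid = CommutativeRing.+-commutativeMonoid xor-∧-commutativeRing

  open import Algebra.Properties.CommutativeMonoid.Sum ⊕-commutativeMonoid public
    using (sum; ∑-distrib-+; sum-cong-≗)
  open SupportedSum ⊕-commutativeMonoid public

  -- Every off-diagonal entry occurs twice and cancels.
  sum-symmetric : ∀ {m} (g : Fin m → Fin m → Bool) → (∀ i j → g i j ≡ g j i) →
                  (∀ i → g i i ≡ false) → sum (λ i → sum (g i)) ≡ false
  sum-symmetric {zero}  g g-sym g-diag = refl
  sum-symmetric {suc m} g g-sym g-diag = begin
    (g 0F 0F xor row) xor sum (λ i → g (s i) 0F xor sum (g (s i) ∘ s))
      ≡⟨ cong₂ (λ x y → (x xor row) xor y) (g-diag 0F)
               (∑-distrib-+ (λ i → g (s i) 0F) (λ i → sum (g (s i) ∘ s))) ⟩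
    row xor (sum (λ i → g (s i) 0F) xor sum (λ i → sum (g (s i) ∘ s)))
      ≡⟨ cong₂ (λ x y → row xor (x xor y)) (sum-cong-≗ (λ i → g-sym (s i) 0F))
               (sum-symmetric (λ i j → g (s i) (s j)) (λ i j → g-sym (s i) (s j)) (g-diag ∘ s)) ⟩
    row xor (row xor false)
      ≡⟨ cong (row xor_) (xor-identityʳ row) ⟩
    row xor row
      ≡⟨ xor-same row ⟩
    false ∎
    where
    open ≡-Reasoning
    s : Fin m → Fin (suc m)
    s = Fin.suc
    row : Bool
    row = sum (g 0F ∘ s)

data SupportSize {m} (f : Fin m → Bool) : Set where
  size0  : (∀ x → ¬ T (f x)) → SupportSize f
  size1  : ∀ {a} → T (f a) → (∀ x → T (f x) → x ≡ a) → SupportSize f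
  size2  : ∀ {a b} → a ≢ b → T (f a) → T (f b) → (∀ x → T (f x) → x ≡ a ⊎ x ≡ b) → SupportSize f
  size≥3 : ∀ {a b c} → a ≢ b → a ≢ c → b ≢ c → T (f a) → T (f b) → T (f c) → SupportSize f

supportSize : ∀ {m} (f : Fin m → Bool) → SupportSize f
supportSize f with any? (λ a → T? (f a))
... | no none = size0 (λ x fx → none (x , fx))
... | yes (a , fa) with any? (λ b → T? (f b) ×-dec ¬? (b ≟ a))
...   | no only-a = size1 fa (λ x fx → decidable-stable (x ≟ a) (λ x≢a → only-a (x , fx , x≢a)))
...   | yes (b , fb , b≢a) with any? (λ c → T? (f c) ×-dec ¬? (c ≟ a) ×-dec ¬? (c ≟ b))
...     | yes (c , fc , c≢a , c≢b) = size≥3 (b≢a ∘ sym) (c≢a ∘ sym) (c≢b ∘ sym) fa fb fc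
...     | no only-ab = size2 (b≢a ∘ sym) fa fb a-or-b
  where
  a-or-b : ∀ x → T (f x) → x ≡ a ⊎ x ≡ b
  a-or-b x fx with x ≟ a | x ≟ b
  ... | yes x≡a | _       = inj₁ x≡a
  ... | no _    | yes x≡b = inj₂ x≡b
  ... | no x≢a  | no x≢b  = ⊥-elim (only-ab (x , fx , x≢a , x≢b))

isomorphic-by-enumeration : ∀ {V : Set} {J} {R : BRel V} {S : BRel (Fin J)} → Connected R →
  (x : Fin J → V) → Fin J → (∀ {i j} → x i ≡ x j → i ≡ j) →
  (∀ i v → T (R (x i) v) → Σ (Fin J) λ j → x j ≡ v) →
  (∀ i j → T (R (x i) (x j)) ⇔ T (S i j)) → Isomorphic R S
isomorphic-by-enumeration {V} {J} {R} {S} (_ , walk) x i₀ x-injective closed R⇔S =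
  mk↔ₛ′ index x (λ i → x-injective (index-correct (x i))) index-correct , adjacency
  where
  reach : ∀ {u v} → Reach R u v → Σ (Fin J) (λ i → x i ≡ u) → Σ (Fin J) λ j → x j ≡ v
  reach ε                 found        = found
  reach (_◅_ {j = w} p r) (i , refl) = reach r (closed i w p)

  located : ∀ v → Σ (Fin J) λ j → x j ≡ v
  located v = reach (walk (x i₀) v) (i₀ , refl)

  index : V → Fin J
  index = proj₁ ∘ located

  index-correct : ∀ v → x (index v) ≡ v
  index-correct = proj₂ ∘ located

  adjacency : ∀ u v → R u v ≡ S (index u) (index v)
  adjacency u v = trans (sym (cong₂ R (index-correct u) (index-correct v))) (T-ext (R⇔S (index u) (index v)))


avoiding-reverse : ∀ {V : Set} {R : BRel V} → (∀ {x y} → T (R x y) → T (R y x)) →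
                   ∀ {a b x y} → ReachAvoiding R a b x y → ReachAvoiding R a b y x
avoiding-reverse R-sym = reverse (λ {x} {y} (r , avoid) →
  R-sym {x} {y} r , avoid ∘ Data.Sum.swap ∘ Data.Sum.map Data.Product.swap Data.Product.swap)

avoiding-swap : ∀ {V : Set} {R : BRel V} {a b x y} → ReachAvoiding R a b x y → ReachAvoiding R b a x y
avoiding-swap = gmap id (λ (r , avoid) → r , avoid ∘ Data.Sum.swap)

pathAdj⇔ : ∀ {k} (i j : Fin k) → T (pathAdj k i j) ⇔ (toℕ j ≡ suc (toℕ i) ⊎ toℕ i ≡ suc (toℕ j))
pathAdj⇔ i j = ⇔-trans (T-∨ {⌊ toℕ j ℕ.≟ suc (toℕ i) ⌋})
                       (T-⌊⌋ (toℕ j ℕ.≟ suc (toℕ i)) ⊎-⇔ T-⌊⌋ (toℕ i ℕ.≟ suc (toℕ j)))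

cycleAdj⇔ : ∀ {k} (i j : Fin k) → T (cycleAdj k i j) ⇔
  (T (pathAdj k i j) ⊎ (toℕ i ≡ 0 × toℕ j ≡ k ℕ.∸ 1) ⊎ (toℕ j ≡ 0 × toℕ i ≡ k ℕ.∸ 1))
cycleAdj⇔ {k} i j = ⇔-trans (T-∨ {pathAdj k i j}) (⇔-refl ⊎-⇔ ⇔-trans (T-∨ {⌊ toℕ i ℕ.≟ 0 ⌋ ∧ _})
  (⇔-trans T-∧ (T-⌊⌋ (toℕ i ℕ.≟ 0) ×-⇔ T-⌊⌋ (toℕ j ℕ.≟ k ℕ.∸ 1)) ⊎-⇔
   ⇔-trans T-∧ (T-⌊⌋ (toℕ j ℕ.≟ 0) ×-⇔ T-⌊⌋ (toℕ i ℕ.≟ k ℕ.∸ 1))))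

pathAdj-from-zero : ∀ {k} m (m<1+k : m < suc k) → Reach (pathAdj (suc k)) Fin.zero (fromℕ< m<1+k)
pathAdj-from-zero zero    _       = ε
pathAdj-from-zero (suc m) 2+m≤1+k = pathAdj-from-zero m m<1+k ◅◅ step ◅ ε
  where
  m<1+k : m < _
  m<1+k = m<n⇒m<1+n (≤-pred 2+m≤1+k)
  step : T (pathAdj _ (fromℕ< m<1+k) (fromℕ< 2+m≤1+k))
  step = Equivalence.from (pathAdj⇔ _ _)
           (inj₁ (trans (toℕ-fromℕ< 2+m≤1+k) (cong suc (sym (toℕ-fromℕ< m<1+k)))))

cycle-connected : ∀ {V : Set} {R : BRel V} → (∀ {x y} → T (R x y) → T (R y x)) →
                  IsCycleGraph R → Connected R
cycle-connected {V} {R} R-sym (suc k , _ , f , f-adj) = root , λ a b → reverse R-sym (reach a) ◅◅ reach b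
  where
  open Inverse f
  root : V
  root = from Fin.zero
  back : ∀ {i j} → T (pathAdj (suc k) i j) → T (R (from i) (from j))
  back {i} {j} p = subst T (sym (trans (f-adj (from i) (from j))
                                      (cong₂ (cycleAdj (suc k)) (strictlyInverseˡ i) (strictlyInverseˡ j))))
                           (Equivalence.from (cycleAdj⇔ i j) (inj₁ p))
  reach : ∀ a → Reach R root a
  reach a = subst (Reach R root) (trans (cong from (fromℕ<-toℕ (to a) (toℕ<n (to a)))) (strictlyInverseʳ a))
              (gmap from back (pathAdj-from-zero (toℕ (to a)) (toℕ<n (to a))))

pattern arc u v p = (u , v) , p

module Arcs {n : ℕ} (X : Graph n) where

  infix 4 _~_ _⇝_

  _~_ : Fin n → Fin n → Set
  u ~ v = T (adj X u v)

  ~-sym : ∀ {u v} → u ~ v → v ~ u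
  ~-sym {u} {v} = subst T (adj-sym X u v)

  ~-irrefl : ∀ {u} → ¬ u ~ u
  ~-irrefl {u} = subst T (loopless X u)

  ~⇒≢ : ∀ {u v} → u ~ v → u ≢ v
  ~⇒≢ p refl = ~-irrefl p

  Arc : Set
  Arc = DirEdge X

  src tgt : Arc → Fin n
  src (arc u _ _) = u
  tgt (arc _ v _) = v

  src≢⇒≢ : ∀ {a b} → src a ≢ src b → a ≢ b
  src≢⇒≢ ne = ne ∘ cong src

  tgt≢⇒≢ : ∀ {a b} → tgt a ≢ tgt b → a ≢ b
  tgt≢⇒≢ ne = ne ∘ cong tgt

  arc-cong : ∀ {u v x y} {p : u ~ v} {q : x ~ y} → u ≡ x → v ≡ y → arc u v p ≡ arc x y q
  arc-cong {p = p} {q} refl refl = cong (arc _ _) (T-irrelevant p q)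

  edge-or-not : ∀ u v → u ~ v ⊎ ¬ u ~ v
  edge-or-not u v with T? (adj X u v)
  ... | yes u~v = inj₁ u~v
  ... | no ¬u~v = inj₂ ¬u~v

  _≟ᵃ_ : (a b : Arc) → Dec (a ≡ b)
  arc u v p ≟ᵃ arc x y q with u ≟ x | v ≟ y
  ... | yes u≡x | yes v≡y = yes (arc-cong u≡x v≡y)
  ... | no u≢x  | _       = no (src≢⇒≢ u≢x)
  ... | _       | no v≢y  = no (tgt≢⇒≢ v≢y)

  _⇝_ : Arc → Arc → Set
  a ⇝ b = T (γ X a b)

  ⇝-cases : ∀ {u v x y} {p : u ~ v} {q : x ~ y} → arc u v p ⇝ arc x y q →
            (v ≡ x × y ≢ u) ⊎ (y ≡ u × x ≢ v)
  ⇝-cases {u} {v} {x} {y} h with v ≟ x | y ≟ u | x ≟ v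
  ... | yes v≡x | no y≢u  | _       = inj₁ (v≡x , y≢u)
  ... | yes _   | yes y≡u | no x≢v  = inj₂ (y≡u , x≢v)
  ... | no _    | yes y≡u | no x≢v  = inj₂ (y≡u , x≢v)
  ... | no v≢x  | yes _   | yes x≡v = ⊥-elim (v≢x (sym x≡v))

  ⇝-continue : ∀ {u v w} (p : u ~ v) (q : v ~ w) → w ≢ u → arc u v p ⇝ arc v w q
  ⇝-continue {u} {v} {w} _ _ w≢u with v ≟ v | w ≟ u
  ... | yes _  | no _    = tt
  ... | no v≢v | _       = ⊥-elim (v≢v refl)
  ... | yes _  | yes w≡u = ⊥-elim (w≢u w≡u)

  ⇝-precede : ∀ {x u v} (p : u ~ v) (q : x ~ u) → x ≢ v → arc u v p ⇝ arc x u q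
  ⇝-precede {x} {u} {v} _ _ x≢v with u ≟ u | x ≟ v
  ... | yes _  | no _    = Equivalence.from T-∨ (inj₂ tt)
  ... | no u≢u | _       = ⊥-elim (u≢u refl)
  ... | yes _  | yes x≡v = ⊥-elim (x≢v x≡v)

  ⇝-sym : ∀ {a b} → a ⇝ b → b ⇝ a
  ⇝-sym {arc u v p} {arc x y q} h with ⇝-cases {p = p} {q = q} h
  ... | inj₁ (refl , y≢u) = ⇝-precede q p (y≢u ∘ sym)
  ... | inj₂ (refl , x≢v) = ⇝-continue q p (x≢v ∘ sym)

  ArcWalk : Arc → Arc → Set
  ArcWalk = Reach (γ X)

  ArcWalk-sym : ∀ {a b} → ArcWalk a b → ArcWalk b a
  ArcWalk-sym = reverse (λ {a} {b} → ⇝-sym {a} {b})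

  Walk : Fin n → Fin n → Set
  Walk = Reach (adj X)

module Degree {n : ℕ} (X : Graph n) where
  open Arcs X
  open ℕ-Sum

  boolToℕ-T : ∀ {b} → T b → boolToℕ b ≡ 1
  boolToℕ-T {true} _ = refl

  boolToℕ-¬T : ∀ {b} → ¬ T b → boolToℕ b ≡ 0
  boolToℕ-¬T {true}  ¬t = ⊥-elim (¬t tt)
  boolToℕ-¬T {false} _  = refl

  degree≡sum : ∀ v → degree X v ≡ sum (boolToℕ ∘ adj X v)
  degree≡sum v = trans (cong ListAction.sum (map-tabulate id (boolToℕ ∘ adj X v)))
                       (sum-tabulate (boolToℕ ∘ adj X v))

  degree-size1 : ∀ {v a} → v ~ a → (∀ x → v ~ x → x ≡ a) → degree X v ≡ 1
  degree-size1 {v} {a} v~a only = begin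
    degree X v                    ≡⟨ degree≡sum v ⟩
    sum (boolToℕ ∘ adj X v)       ≡⟨ sum-single _ a (λ x x≢a → boolToℕ-¬T (x≢a ∘ only x)) ⟩
    boolToℕ (adj X v a)           ≡⟨ boolToℕ-T v~a ⟩
    1                             ∎
    where open ≡-Reasoning

  degree-size2 : ∀ {v a b} → a ≢ b → v ~ a → v ~ b → (∀ x → v ~ x → x ≡ a ⊎ x ≡ b) → degree X v ≡ 2
  degree-size2 {v} {a} {b} a≢b v~a v~b only = begin
    degree X v                                ≡⟨ degree≡sum v ⟩
    sum (boolToℕ ∘ adj X v)                   ≡⟨ sum-pair _ a≢b (λ x x≢a x≢b → boolToℕ-¬T ([ x≢a , x≢b ] ∘ only x)) ⟩
    boolToℕ (adj X v a) + boolToℕ (adj X v b) ≡⟨ cong₂ _+_ (boolToℕ-T v~a) (boolToℕ-T v~b) ⟩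
    2                                         ∎
    where open ≡-Reasoning

  2≤degree : ∀ {v a b} → a ≢ b → v ~ a → v ~ b → 2 ≤ degree X v
  2≤degree {v} {a} {b} a≢b v~a v~b = subst₂ _≤_
    (cong₂ _+_ (boolToℕ-T v~a) (boolToℕ-T v~b)) (sym (degree≡sum v))
    (≤-sum₂ (boolToℕ ∘ adj X v) a≢b)

  3≤degree : ∀ {v a b c} → a ≢ b → a ≢ c → b ≢ c → v ~ a → v ~ b → v ~ c → 3 ≤ degree X v
  3≤degree {v} a≢b a≢c b≢c v~a v~b v~c = subst₂ _≤_
    (cong₂ _+_ (boolToℕ-T v~a) (cong₂ _+_ (boolToℕ-T v~b) (boolToℕ-T v~c))) (sym (degree≡sum v))
    (≤-sum₃ (boolToℕ ∘ adj X v) a≢b a≢c b≢c)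

  degree≡1⇒unique-neighbour : ∀ {u v} → degree X u ≡ 1 → u ~ v → ∀ y → u ~ y → y ≡ v
  degree≡1⇒unique-neighbour {u} {v} deg u~v y u~y with y ≟ v
  ... | yes y≡v = y≡v
  ... | no y≢v  = ⊥-elim (2≰1 (subst (2 ≤_) deg (2≤degree y≢v u~y u~v)))
    where
    2≰1 : ¬ 2 ≤ 1
    2≰1 (s≤s ())

  degree≡2⇒other-neighbour : ∀ {v u} → degree X v ≡ 2 → v ~ u →
    Σ (Fin n) λ w → v ~ w × w ≢ u × (∀ y → v ~ y → y ≡ u ⊎ y ≡ w)
  degree≡2⇒other-neighbour {v} {u} deg v~u with supportSize (adj X v)
  ... | size0 none = ⊥-elim (none u v~u)
  ... | size1 v~a only = ⊥-elim (1≢2 (trans (sym (degree-size1 v~a only)) deg))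
    where
    1≢2 : 1 ≢ 2
    1≢2 ()
  ... | size≥3 a≢b a≢c b≢c v~a v~b v~c = ⊥-elim (3≰2 (subst (3 ≤_) deg (3≤degree a≢b a≢c b≢c v~a v~b v~c)))
    where
    3≰2 : ¬ 3 ≤ 2
    3≰2 (s≤s (s≤s ()))
  ... | size2 {a} {b} a≢b v~a v~b only with only u v~u
  ...   | inj₁ refl = b , v~b , a≢b ∘ sym , only
  ...   | inj₂ refl = a , v~a , a≢b , λ y v~y → Data.Sum.swap (only y v~y)

-- (3) Bipartiteness

module WalkParity {n : ℕ} (X : Graph n) where
  open Arcs X

  parity : ∀ {a b} → Walk a b → Bool
  parity ε       = false
  parity (_ ◅ w) = not (parity w)

  length : ∀ {a b} → Walk a b → ℕ
  length ε       = 0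
  length (_ ◅ w) = suc (length w)

  parity-◅◅ : ∀ {a b c} (w : Walk a b) (v : Walk b c) → parity (w ◅◅ v) ≡ parity w xor parity v
  parity-◅◅ ε       v = refl
  parity-◅◅ (_ ◅ w) v = trans (cong not (parity-◅◅ w v)) (not-distribˡ-xor (parity w) (parity v))

  length-◅◅ : ∀ {a b c} (w : Walk a b) (v : Walk b c) → length (w ◅◅ v) ≡ length w + length v
  length-◅◅ ε       v = refl
  length-◅◅ (_ ◅ w) v = cong suc (length-◅◅ w v)

  parity-revApp : ∀ {a b c} (w : Walk b a) (v : Walk b c) →
                  parity (revApp ~-sym w v) ≡ parity w xor parity v
  parity-revApp ε       v = refl
  parity-revApp (_ ◅ w) v = begin
    parity (revApp ~-sym w (_ ◅ v)) ≡⟨ parity-revApp w (_ ◅ v) ⟩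
    parity w xor not (parity v)     ≡⟨ sym (not-distribʳ-xor (parity w) (parity v)) ⟩
    not (parity w xor parity v)     ≡⟨ not-distribˡ-xor (parity w) (parity v) ⟩
    not (parity w) xor parity v     ∎
    where open ≡-Reasoning

  parity-cons-snoc : ∀ {a j c b} (e : a ~ j) (w : Walk j c) (e′ : c ~ b) →
                     parity (e ◅ w ◅◅ e′ ◅ ε) ≡ parity w
  parity-cons-snoc e w e′ = begin
    not (parity (w ◅◅ e′ ◅ ε))  ≡⟨ cong not (parity-◅◅ w (e′ ◅ ε)) ⟩
    not (parity w xor true)     ≡⟨ not-distribʳ-xor (parity w) true ⟩
    parity w xor false          ≡⟨ xor-identityʳ (parity w) ⟩
    parity w                    ∎
    where open ≡-Reasoning

  parity-reverse : ∀ {a b} (w : Walk a b) → parity (reverse ~-sym w) ≡ parity w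
  parity-reverse w = trans (parity-revApp w ε) (xor-identityʳ (parity w))

  NonBacktracking : ∀ {a b} → Walk a b → Set
  NonBacktracking ε                                  = ⊤
  NonBacktracking (_ ◅ ε)                            = ⊤
  NonBacktracking (_◅_ {i = a} _ (_◅_ {j = c} e w)) = c ≢ a × NonBacktracking (e ◅ w)

  nonBacktracking-tail : ∀ {a j b} (e : a ~ j) (w : Walk j b) →
                         NonBacktracking (e ◅ w) → NonBacktracking w
  nonBacktracking-tail e ε       _        = tt
  nonBacktracking-tail e (_ ◅ _) (_ , nb) = nb

  nonBacktracking-prefix : ∀ {a b c} (w : Walk a b) (v : Walk b c) →
                           NonBacktracking (w ◅◅ v) → NonBacktracking w
  nonBacktracking-prefix ε             v _          = tt
  nonBacktracking-prefix (_ ◅ ε)       v _          = tt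
  nonBacktracking-prefix (_ ◅ e ◅ w)   v (c≢a , nb) = c≢a , nonBacktracking-prefix (e ◅ w) v nb

  NonBacktrackingWalk : Fin n → Fin n → Set
  NonBacktrackingWalk a b = Σ (Walk a b) NonBacktracking

  cons-nonBacktracking : ∀ {a j b} (e : a ~ j) (w : Walk j b) → NonBacktracking w →
    Σ (NonBacktrackingWalk a b) λ (v , _) → parity v ≡ parity (e ◅ w)
  cons-nonBacktracking e ε _ = (e ◅ ε , tt) , refl
  cons-nonBacktracking {a} e (_◅_ {j = c} e′ w) nb with c ≟ a
  ... | yes refl = (w , nonBacktracking-tail e′ w nb) , sym (not-involutive (parity w))
  ... | no c≢a   = (e ◅ e′ ◅ w , c≢a , nb) , refl

  reduce : ∀ {a b} (w : Walk a b) → Σ (NonBacktrackingWalk a b) λ (v , _) → parity v ≡ parity w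
  reduce ε = (ε , tt) , refl
  reduce (e ◅ w) with reduce w
  ... | (v , nb) , v≡w with cons-nonBacktracking e v nb
  ...   | r , r≡ev = r , trans r≡ev (cong not v≡w)

  data SnocView {a} : ∀ {b} → Walk a b → Set where
    []   : SnocView ε
    _∷ʳ_ : ∀ {c b} (w : Walk a c) (e : c ~ b) → SnocView (w ◅◅ e ◅ ε)

  snocView : ∀ {a b} (w : Walk a b) → SnocView w
  snocView ε = []
  snocView (e ◅ w) with snocView w
  ... | []      = ε ∷ʳ e
  ... | v ∷ʳ e′ = (e ◅ v) ∷ʳ e′

  lastArc : ∀ {a j b} → a ~ j → Walk j b → Arc
  lastArc e ε        = arc _ _ e
  lastArc _ (e′ ◅ w) = lastArc e′ w

  lastArc-snoc : ∀ {a j c b} (e : a ~ j) (w : Walk j c) (e′ : c ~ b) →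
                 lastArc e (w ◅◅ e′ ◅ ε) ≡ arc c b e′
  lastArc-snoc e ε        e′ = refl
  lastArc-snoc e (e₁ ◅ w) e′ = lastArc-snoc e₁ w e′

module ArcColouring {n : ℕ} (X : Graph n) (colour : DirEdge X → Bool)
                    (proper : ∀ a b → T (γ X a b) → colour a ≢ colour b) where
  open Arcs X
  open WalkParity X

  colour-⇝ : ∀ {a b} → a ⇝ b → colour b ≡ not (colour a)
  colour-⇝ {a} {b} h = ¬-not (proper a b h ∘ sym)

  -- A non-backtracking walk lifts to a walk in γ(X), along which the colour alternates.
  colour-lastArc : ∀ {a j b} (e : a ~ j) (w : Walk j b) → NonBacktracking (e ◅ w) →
                   colour (lastArc e w) ≡ colour (arc a j e) xor parity w
  colour-lastArc e ε        _          = sym (xor-identityʳ _)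
  colour-lastArc {a} {j} e (_◅_ {j = c} e′ w) (c≢a , nb) = begin
    colour (lastArc e′ w)                   ≡⟨ colour-lastArc e′ w nb ⟩
    colour (arc j c e′) xor parity w        ≡⟨ cong (_xor parity w) (colour-⇝ (⇝-continue e e′ c≢a)) ⟩
    not (colour (arc a j e)) xor parity w   ≡⟨ sym (not-distribˡ-xor (colour (arc a j e)) (parity w)) ⟩
    not (colour (arc a j e) xor parity w)   ≡⟨ not-distribʳ-xor (colour (arc a j e)) (parity w) ⟩
    colour (arc a j e) xor not (parity w)   ∎
    where open ≡-Reasoning

  -- A closed walk ending along its first edge is shortened at both ends; otherwise its last and
  -- first arcs are γ-adjacent, so the alternating colour forces even length.
  closed-nonBacktracking-even : ∀ fuel {a} (w : Walk a a) → length w ≤ fuel →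
                                NonBacktracking w → parity w ≡ false
  closed-nonBacktracking-even _ ε _ _ = refl
  closed-nonBacktracking-even (suc fuel) (_◅_ {j = j} e w) (s≤s len≤fuel) nb with snocView w
  ... | [] = ⊥-elim (~-irrefl e)
  ... | _∷ʳ_ {c = c} m e′ with c ≟ j
  ...   | yes refl = trans (parity-cons-snoc e m e′) (closed-nonBacktracking-even fuel m len-m≤fuel nb-m)
    where
    len-m≤fuel : length m ≤ fuel
    len-m≤fuel = m+n≤o⇒m≤o (length m) (subst (_≤ fuel) (length-◅◅ m (e′ ◅ ε)) len≤fuel)
    nb-m : NonBacktracking m
    nb-m = nonBacktracking-prefix m (e′ ◅ ε) (nonBacktracking-tail e (m ◅◅ e′ ◅ ε) nb)
  ...   | no c≢j = fixed (colour (arc _ j e)) (parity (m ◅◅ e′ ◅ ε)) (begin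
    colour (arc _ j e)                                   ≡⟨ colour-⇝ (⇝-continue e′ e (c≢j ∘ sym)) ⟩
    not (colour (arc c _ e′))                            ≡⟨ cong (not ∘ colour) (lastArc-snoc e m e′) ⟨
    not (colour (lastArc e (m ◅◅ e′ ◅ ε)))               ≡⟨ cong not (colour-lastArc e (m ◅◅ e′ ◅ ε) nb) ⟩
    not (colour (arc _ j e) xor parity (m ◅◅ e′ ◅ ε))   ∎)
    where
    open ≡-Reasoning
    fixed : ∀ x q → x ≡ not (x xor q) → not q ≡ false
    fixed true  true  _ = refl
    fixed false true  _ = refl
    fixed true  false ()
    fixed false false ()

  closed-even : ∀ {a} (w : Walk a a) → parity w ≡ false
  closed-even w with reduce w
  ... | (v , nb) , v≡w = trans (sym v≡w) (closed-nonBacktracking-even (length v) v ≤-refl nb)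

bipartite⇒γ-bipartite : ∀ {n} (X : Graph n) → Bipartite (adj X) → Bipartite (γ X)
bipartite⇒γ-bipartite X (c , proper) = c ∘ src , colour-src-proper
  where
  open Arcs X
  colour-src-proper : ∀ a b → a ⇝ b → c (src a) ≢ c (src b)
  colour-src-proper (arc u v p) (arc x y q) h with ⇝-cases {p = p} {q = q} h
  ... | inj₁ (refl , _) = proper u v p
  ... | inj₂ (refl , _) = proper x u q ∘ sym

γ-bipartite⇒bipartite : ∀ {n} (X : Graph n) → Connected (adj X) →
                        Bipartite (γ X) → Bipartite (adj X)
γ-bipartite⇒bipartite X (r , walk) (colour , proper) = parity ∘ walk r , parity-proper
  where
  open Arcs X
  open WalkParity X
  open ArcColouring X colour proper
  parity-proper : ∀ a b → a ~ b → parity (walk r a) ≢ parity (walk r b)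
  parity-proper a b p same = true≢false (begin
    true                                  ≡⟨ xor-inverseʳ φa ⟨
    φa xor not φa                         ≡⟨ cong (λ x → φa xor not x) same ⟩
    φa xor not (parity (walk r b))        ≡⟨ cong (λ x → φa xor not x) (parity-reverse (walk r b)) ⟨
    φa xor parity (p ◅ back)              ≡⟨ parity-◅◅ (walk r a) (p ◅ back) ⟨
    parity (walk r a ◅◅ p ◅ back)         ≡⟨ closed-even (walk r a ◅◅ p ◅ back) ⟩
    false                                 ∎)
    where
    open ≡-Reasoning
    φa : Bool
    φa = parity (walk r a)
    back : Walk b r
    back = reverse ~-sym (walk r b)
    true≢false : true ≢ false
    true≢false ()

-- (1) Connectivity of γ(X)

MaxDegree≤2 : ∀ {V : Set} → BRel V → Set
MaxDegree≤2 R = ∀ z {a b c} → T (R z a) → T (R z b) → T (R z c) → a ≡ b ⊎ a ≡ c ⊎ b ≡ c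

record LinearOrientation {V : Set} (R : BRel V) : Set₁ where
  field
    _↦_          : V → V → Set
    orient       : ∀ {u v} → T (R u v) → u ↦ v ⊎ v ↦ u
    ↦-asym       : ∀ {u v} → u ↦ v → ¬ v ↦ u
    ↦-in-unique  : ∀ {u u′ v} → u ↦ v → u′ ↦ v → u ≡ u′
    ↦-out-unique : ∀ {u v v′} → u ↦ v → u ↦ v′ → v ≡ v′

  -- The three edges at a vertex would need two out-going or two in-coming arcs.
  maxDegree≤2 : MaxDegree≤2 R
  maxDegree≤2 z za zb zc with orient za | orient zb | orient zc
  ... | inj₁ z↦a | inj₁ z↦b | _        = inj₁ (↦-out-unique z↦a z↦b)
  ... | inj₂ a↦z | inj₂ b↦z | _        = inj₁ (↦-in-unique a↦z b↦z)
  ... | inj₁ z↦a | inj₂ _   | inj₁ z↦c = inj₂ (inj₁ (↦-out-unique z↦a z↦c))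
  ... | inj₁ _   | inj₂ b↦z | inj₂ c↦z = inj₂ (inj₂ (↦-in-unique b↦z c↦z))
  ... | inj₂ _   | inj₁ z↦b | inj₁ z↦c = inj₂ (inj₂ (↦-out-unique z↦b z↦c))
  ... | inj₂ a↦z | inj₁ _   | inj₂ c↦z = inj₂ (inj₁ (↦-in-unique a↦z c↦z))

pullback : ∀ {V W} {R : BRel V} {S : BRel W} → Isomorphic R S → LinearOrientation S → LinearOrientation R
pullback {R = R} (f , f-adj) o = record
  { _↦_          = λ u v → to u ↦ to v
  ; orient       = λ {u} {v} uv → orient (subst T (f-adj u v) uv)
  ; ↦-asym       = ↦-asym
  ; ↦-in-unique  = λ u↦v u′↦v → to-injective (↦-in-unique u↦v u′↦v)
  ; ↦-out-unique = λ u↦v u↦v′ → to-injective (↦-out-unique u↦v u↦v′)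
  }
  where
  open LinearOrientation o
  open Injection (↔⇒↣ f) renaming (injective to to-injective)

successor-asym : ∀ {x y} → y ≡ suc x → ¬ x ≡ suc y
successor-asym {x} refl x≡2+x = m≢1+m+n x (trans x≡2+x (cong suc (+-comm 1 x)))

pathAdj-linear : ∀ k → LinearOrientation (pathAdj k)
pathAdj-linear k = record
  { _↦_          = λ i j → toℕ j ≡ suc (toℕ i)
  ; orient       = λ {i} {j} → Equivalence.to (pathAdj⇔ i j)
  ; ↦-asym       = successor-asym
  ; ↦-in-unique  = λ i↦j i′↦j → toℕ-injective (suc-injective (trans (sym i↦j) i′↦j))
  ; ↦-out-unique = λ i↦j i↦j′ → toℕ-injective (trans i↦j (sym i↦j′))
  }

cycleAdj-linear : ∀ k → 3 ≤ k → LinearOrientation (cycleAdj k)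
cycleAdj-linear k@(suc (suc (suc m))) (s≤s (s≤s (s≤s _))) = record
  { _↦_ = _↦_ ; orient = orient ; ↦-asym = asym ; ↦-in-unique = in-unique ; ↦-out-unique = out-unique }
  where
  _↦_ : Fin k → Fin k → Set
  i ↦ j = toℕ j ≡ suc (toℕ i) ⊎ (toℕ i ≡ suc (suc m) × toℕ j ≡ 0)

  orient : ∀ {i j} → T (cycleAdj k i j) → i ↦ j ⊎ j ↦ i
  orient {i} {j} h with Equivalence.to (cycleAdj⇔ i j) h
  ... | inj₁ step                  = Data.Sum.map inj₁ inj₁ (Equivalence.to (pathAdj⇔ i j) step)
  ... | inj₂ (inj₁ (i≡0 , j≡last)) = inj₂ (inj₂ (j≡last , i≡0))
  ... | inj₂ (inj₂ (j≡0 , i≡last)) = inj₁ (inj₂ (i≡last , j≡0))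

  1≢2+m : 1 ≢ suc (suc m)
  1≢2+m ()

  asym : ∀ {i j} → i ↦ j → ¬ j ↦ i
  asym (inj₁ j≡1+i)          (inj₁ i≡1+j)          = successor-asym j≡1+i i≡1+j
  asym (inj₁ j≡1+i)          (inj₂ (j≡last , i≡0)) = 1≢2+m (trans (cong suc (sym i≡0)) (trans (sym j≡1+i) j≡last))
  asym (inj₂ (i≡last , j≡0)) (inj₁ i≡1+j)          = 1≢2+m (trans (cong suc (sym j≡0)) (trans (sym i≡1+j) i≡last))
  asym (inj₂ (_ , j≡0))      (inj₂ (j≡last , _))   = 1+n≢0 (trans (sym j≡last) j≡0)

  in-unique : ∀ {i i′ j} → i ↦ j → i′ ↦ j → i ≡ i′
  in-unique (inj₁ j≡1+i)        (inj₁ j≡1+i′)        = toℕ-injective (suc-injective (trans (sym j≡1+i) j≡1+i′))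
  in-unique (inj₁ j≡1+i)        (inj₂ (_ , j≡0))     = ⊥-elim (1+n≢0 (trans (sym j≡1+i) j≡0))
  in-unique (inj₂ (_ , j≡0))    (inj₁ j≡1+i′)        = ⊥-elim (1+n≢0 (trans (sym j≡1+i′) j≡0))
  in-unique (inj₂ (i≡last , _)) (inj₂ (i′≡last , _)) = toℕ-injective (trans i≡last (sym i′≡last))

  past-last : ∀ {i j} → toℕ j ≡ suc (toℕ i) → toℕ i ≡ suc (suc m) → ⊥
  past-last {j = j} j≡1+i i≡last = <-irrefl (trans j≡1+i (cong suc i≡last)) (toℕ<n j)

  out-unique : ∀ {i j j′} → i ↦ j → i ↦ j′ → j ≡ j′
  out-unique (inj₁ j≡1+i)        (inj₁ j′≡1+i)       = toℕ-injective (trans j≡1+i (sym j′≡1+i))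
  out-unique (inj₁ j≡1+i)        (inj₂ (i≡last , _)) = ⊥-elim (past-last j≡1+i i≡last)
  out-unique (inj₂ (i≡last , _)) (inj₁ j′≡1+i)       = ⊥-elim (past-last j′≡1+i i≡last)
  out-unique (inj₂ (_ , j≡0))    (inj₂ (_ , j′≡0))   = toℕ-injective (trans j≡0 (sym j′≡0))

linear⇒γ-disconnected : ∀ {n} (X : Graph n) → LinearOrientation (adj X) → ¬ Connected (γ X)
linear⇒γ-disconnected X o (arc u v p , walk) = arc-and-reverse (orient p)
  where
  open Arcs X
  open LinearOrientation o

  Forward : Arc → Set
  Forward a = src a ↦ tgt a

  forward-continue : ∀ {u v y} → u ~ v → v ~ y → y ≢ u → u ↦ v ⇔ v ↦ y
  forward-continue u~v v~y y≢u = mk⇔ continue back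
    where
    continue : _ ↦ _ → _ ↦ _
    continue u↦v with orient v~y
    ... | inj₁ v↦y = v↦y
    ... | inj₂ y↦v = ⊥-elim (y≢u (↦-in-unique y↦v u↦v))
    back : _ ↦ _ → _ ↦ _
    back v↦y with orient u~v
    ... | inj₁ u↦v = u↦v
    ... | inj₂ v↦u = ⊥-elim (y≢u (↦-out-unique v↦y v↦u))

  forward-step : ∀ {a b} → a ⇝ b → Forward a → Forward b
  forward-step {arc u v p} {arc x y q} h with ⇝-cases {p = p} {q = q} h
  ... | inj₁ (refl , y≢u) = Equivalence.to (forward-continue p q y≢u)
  ... | inj₂ (refl , x≢v) = Equivalence.from (forward-continue q p (x≢v ∘ sym))

  forward-walk : ∀ {a b} → ArcWalk a b → Forward a → Forward b
  forward-walk ε       = id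
  forward-walk {a} (_◅_ {j = b} h w) = forward-walk w ∘ forward-step {a} {b} h

  arc-and-reverse : u ↦ v ⊎ v ↦ u → ⊥
  arc-and-reverse (inj₁ u↦v) = ↦-asym u↦v (forward-walk (walk (arc u v p) (arc v u (~-sym p))) u↦v)
  arc-and-reverse (inj₂ v↦u) = ↦-asym v↦u (forward-walk (walk (arc v u (~-sym p)) (arc u v p)) v↦u)

path⇒γ-disconnected : ∀ {n} (X : Graph n) → IsPathGraph (adj X) → ¬ Connected (γ X)
path⇒γ-disconnected X (k , _ , iso) = linear⇒γ-disconnected X (pullback iso (pathAdj-linear k))

cycle⇒γ-disconnected : ∀ {n} (X : Graph n) → IsCycleGraph (adj X) → ¬ Connected (γ X)
cycle⇒γ-disconnected X (k , 3≤k , iso) = linear⇒γ-disconnected X (pullback iso (cycleAdj-linear k 3≤k))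

record Claw {n : ℕ} (X : Graph n) : Set where
  field
    centre a b c : Fin n
    centre~a     : T (adj X centre a)
    centre~b     : T (adj X centre b)
    centre~c     : T (adj X centre c)
    a≢b          : a ≢ b
    a≢c          : a ≢ c
    b≢c          : b ≢ c

claw-or-maxDegree≤2 : ∀ {n} (X : Graph n) → Claw X ⊎ MaxDegree≤2 (adj X)
claw-or-maxDegree≤2 X with any? (λ z → any? (λ a → any? (λ b → any? (λ c →
  T? (adj X z a) ×-dec T? (adj X z b) ×-dec T? (adj X z c) ×-dec ¬? (a ≟ b) ×-dec ¬? (a ≟ c) ×-dec ¬? (b ≟ c)))))
... | yes (z , a , b , c , za , zb , zc , a≢b , a≢c , b≢c) = inj₁ (record
  { centre = z ; a = a ; b = b ; c = c ; centre~a = za ; centre~b = zb ; centre~c = zc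
  ; a≢b = a≢b ; a≢c = a≢c ; b≢c = b≢c })
... | no no-claw = inj₂ two-equal
  where
  two-equal : MaxDegree≤2 (adj X)
  two-equal z {a} {b} {c} za zb zc with a ≟ b | a ≟ c | b ≟ c
  ... | yes a≡b | _       | _       = inj₁ a≡b
  ... | no _    | yes a≡c | _       = inj₂ (inj₁ a≡c)
  ... | no _    | no _    | yes b≡c = inj₂ (inj₂ b≡c)
  ... | no a≢b  | no a≢c  | no b≢c  = ⊥-elim (no-claw (z , a , b , c , za , zb , zc , a≢b , a≢c , b≢c))

claw⇒γ-connected : ∀ {n} (X : Graph n) → Connected (adj X) → Claw X → Connected (γ X)
claw⇒γ-connected {n} X (_ , walk) claw = start , λ e f → ArcWalk-sym (reached e) ◅◅ reached f
  where
  open Arcs X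
  open Claw claw renaming (centre to z; centre~a to z~a; centre~b to z~b; centre~c to z~c)

  start : Arc
  start = arc z a z~a

  Reached : Arc → Set
  Reached = ArcWalk start

  _▸_ : ∀ {e f} → Reached e → e ⇝ f → Reached f
  r ▸ h = r ◅◅ h ◅ ε

  AllArcsReached : Fin n → Set
  AllArcsReached v = ∀ w (p : v ~ w) → Reached (arc v w p) × Reached (arc w v (~-sym p))

  b→z : Reached (arc b z (~-sym z~b))
  b→z = ε ▸ ⇝-precede z~a (~-sym z~b) (a≢b ∘ sym)
  z→c : Reached (arc z c z~c)
  z→c = b→z ▸ ⇝-continue (~-sym z~b) z~c (b≢c ∘ sym)
  a→z : Reached (arc a z (~-sym z~a))
  a→z = z→c ▸ ⇝-precede z~c (~-sym z~a) a≢c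

  at-z : AllArcsReached z
  at-z w z~w with w ≟ a
  ... | yes refl = subst Reached (arc-cong refl refl) ε , subst Reached (arc-cong refl refl) a→z
  ... | no w≢a   = a→z ▸ ⇝-continue (~-sym z~a) z~w w≢a , ε ▸ ⇝-precede z~a (~-sym z~w) w≢a

  along-edge : ∀ {v v′} → v ~ v′ → AllArcsReached v → AllArcsReached v′
  along-edge {v} {v′} v~v′ all-v w v′~w with w ≟ v
  ... | yes refl = subst Reached (arc-cong refl refl) (proj₂ (all-v v′ v~v′)) ,
                   subst Reached (arc-cong refl refl) (proj₁ (all-v v′ v~v′))
  ... | no w≢v   = proj₁ (all-v v′ v~v′) ▸ ⇝-continue v~v′ v′~w w≢v ,
                   proj₂ (all-v v′ v~v′) ▸ ⇝-precede (~-sym v~v′) (~-sym v′~w) w≢v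

  along-walk : ∀ {v v′} → Walk v v′ → AllArcsReached v → AllArcsReached v′
  along-walk ε        = id
  along-walk (p ◅ w)  = along-walk w ∘ along-edge p

  reached : ∀ e → Reached e
  reached (arc u v p) = proj₁ (along-walk (walk z u) at-z v p)

Consecutive : ℕ → ℕ → Set
Consecutive i j = j ≡ suc i ⊎ i ≡ suc j

module MaxDegreeTwo {n : ℕ} (X : Graph n) (deg≤2 : MaxDegree≤2 (adj X)) where
  open Arcs X

  TwoNeighbours : Fin n → Set
  TwoNeighbours v = Σ (Fin n) λ a → Σ (Fin n) λ b → v ~ a × v ~ b × a ≢ b

  twoNeighbours? : ∀ v → Dec (TwoNeighbours v)
  twoNeighbours? v with supportSize (adj X v)
  ... | size0 none                = no λ (a , _ , v~a , _) → none a v~a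
  ... | size1 _ only              = no λ (a , b , v~a , v~b , a≢b) → a≢b (trans (only a v~a) (sym (only b v~b)))
  ... | size2 a≢b v~a v~b _       = yes (_ , _ , v~a , v~b , a≢b)
  ... | size≥3 a≢b _ _ v~a v~b _  = yes (_ , _ , v~a , v~b , a≢b)

  next : (p c : Fin n) → Σ (Fin n) λ y → (c ~ y × y ≢ p) ⊎ (y ≡ p × (∀ y′ → c ~ y′ → y′ ≡ p))
  next p c with any? (λ y → T? (adj X c y) ×-dec ¬? (y ≟ p))
  ... | yes (y , c~y , y≢p) = y , inj₁ (c~y , y≢p)
  ... | no none = p , inj₂ (refl , λ y c~y → decidable-stable (y ≟ p) (λ y≢p → none (y , c~y , y≢p)))

  -- The walk from s that turns back only at vertices of degree one; positions i is the pair of its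
  -- (i-1)-st and i-th vertices.
  module Trail (s : Fin n) {a₀} (s~a₀ : s ~ a₀) where
    positions : ℕ → Fin n × Fin n
    positions zero    = s , s
    positions (suc i) = proj₂ (positions i) , proj₁ (next (proj₁ (positions i)) (proj₂ (positions i)))

    x : ℕ → Fin n
    x = proj₂ ∘ positions

    turn : ∀ i → (x (suc i) ~ x (2 + i) × x (2 + i) ≢ x i) ⊎
                 (x (2 + i) ≡ x i × (∀ y → x (suc i) ~ y → y ≡ x i))
    turn i = proj₂ (next (x i) (x (suc i)))

    edge : ∀ i → x i ~ x (suc i)
    edge zero with proj₂ (next s s)
    ... | inj₁ (s~x₁ , _)  = s~x₁
    ... | inj₂ (_ , only)  = ⊥-elim (~-irrefl (subst (s ~_) (only a₀ s~a₀) s~a₀))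
    edge (suc i) with turn i
    ... | inj₁ (step , _)  = step
    ... | inj₂ (back , _)  = subst (x (suc i) ~_) (sym back) (~-sym (edge i))

    Revisits : ℕ → Set
    Revisits j = Σ (Fin j) λ i → x (toℕ i) ≡ x j

    first-revisit : Σ ℕ λ J → Revisits J × (∀ j → j < J → ¬ Revisits j)
    first-revisit with pigeonhole ≤-refl (x ∘ toℕ {suc n})
    ... | i , j , i<j , same = least Revisits (λ j → any? (λ i → x (toℕ i) ≟ x j))
                                 (fromℕ< i<j , trans (cong x (toℕ-fromℕ< i<j)) same)

    distinct : ∀ {J} → (∀ j → j < J → ¬ Revisits j) → ∀ {a b} → a < J → b < J → x a ≡ x b → a ≡ b
    distinct none {a} {b} a<J b<J xa≡xb with <-cmp a b
    ... | tri< a<b _ _ = ⊥-elim (none b b<J (fromℕ< a<b , trans (cong x (toℕ-fromℕ< a<b)) xa≡xb))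
    ... | tri≈ _ a≡b _ = a≡b
    ... | tri> _ _ b<a = ⊥-elim (none a a<J (fromℕ< b<a , trans (cong x (toℕ-fromℕ< b<a)) (sym xa≡xb)))

    first-loop : Σ ℕ λ k → (∀ j → j < 2 + k → ¬ Revisits j) × Σ (Fin (2 + k)) λ m → x (toℕ m) ≡ x (2 + k)
    first-loop with first-revisit
    ... | suc zero    , (Fin.zero , x₀≡x₁) , _ = ⊥-elim (~-irrefl (subst (_~ x 1) x₀≡x₁ (edge 0)))
    ... | suc (suc k) , revisit , first         = k , first , revisit

    module Loop (k : ℕ) (first : ∀ j → j < 2 + k → ¬ Revisits j)
                (m : Fin (2 + k)) (revisit : x (toℕ m) ≡ x (2 + k)) where
      dist : ∀ {a b} → a < 2 + k → b < 2 + k → x a ≡ x b → a ≡ b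
      dist = distinct first

      inner : ∀ {i} → i < k → i < 2 + k
      inner i<k = m<n⇒m<1+n (m<n⇒m<1+n i<k)

      interior : ∀ {i} → i < k → ∀ y → x (suc i) ~ y → y ≡ x i ⊎ y ≡ x (2 + i)
      interior {i} i<k y e with deg≤2 (x (suc i)) (~-sym (edge i)) (edge (suc i)) e
      ... | inj₁ xi≡x2+i        = ⊥-elim (<⇒≢ (m<n⇒m<1+n (n<1+n i)) (dist (inner i<k) (s≤s (s≤s i<k)) xi≡x2+i))
      ... | inj₂ (inj₁ xi≡y)    = inj₁ (sym xi≡y)
      ... | inj₂ (inj₂ x2+i≡y)  = inj₂ (sym x2+i≡y)

      -- The trail first closes up either at its start (a cycle) or by turning back (a path).
      revisit-index : toℕ m ≡ 0 ⊎ toℕ m ≡ k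
      revisit-index = index-of (toℕ m) (toℕ<n m) revisit
        where
        index-of : ∀ i → i < 2 + k → x i ≡ x (2 + k) → i ≡ 0 ⊎ i ≡ k
        index-of zero    _           _   = inj₁ refl
        index-of (suc i) (s≤s i<1+k) rev with m<1+n⇒m<n∨m≡n i<1+k
        ... | inj₂ refl = ⊥-elim (~-irrefl (subst (x (suc k) ~_) (sym rev) (edge (suc k))))
        ... | inj₁ i<k with interior i<k (x (suc k)) (subst (_~ x (suc k)) (sym rev) (~-sym (edge (suc k))))
        ...   | inj₁ back = ⊥-elim (<⇒≢ (m<n⇒m<1+n i<k) (sym (dist ≤-refl (inner i<k) back)))
        ...   | inj₂ on   = inj₂ (sym (suc-injective (dist ≤-refl (s≤s (s≤s i<k)) on)))

      Neighbours : (ℕ → ℕ → Set) → Set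
      Neighbours Rel = ∀ i → i < 2 + k → ∀ y → x i ~ y → Σ ℕ λ j → j < 2 + k × x j ≡ y × Rel i j

      enumerate : ∀ {Rel : ℕ → ℕ → Set} {S : BRel (Fin (2 + k))} → Connected (adj X) →
        Neighbours Rel → (∀ {i j} → Rel i j → x i ~ x j) →
        (∀ (i j : Fin (2 + k)) → Rel (toℕ i) (toℕ j) ⇔ T (S i j)) → Isomorphic (adj X) S
      enumerate {Rel} conn neighbours adjacent Rel⇔S =
        isomorphic-by-enumeration conn (x ∘ toℕ) Fin.zero injective closed
          (λ i j → ⇔-trans (mk⇔ (forward i j) adjacent) (Rel⇔S i j))
        where
        injective : ∀ {i j} → x (toℕ i) ≡ x (toℕ j) → i ≡ j
        injective {i} {j} = toℕ-injective ∘ dist (toℕ<n i) (toℕ<n j)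
        closed : ∀ i v → x (toℕ i) ~ v → Σ (Fin (2 + k)) λ j → x (toℕ j) ≡ v
        closed i v e with neighbours (toℕ i) (toℕ<n i) v e
        ... | j , j< , xj≡v , _ = fromℕ< j< , trans (cong x (toℕ-fromℕ< j<)) xj≡v
        forward : ∀ i j → x (toℕ i) ~ x (toℕ j) → Rel (toℕ i) (toℕ j)
        forward i j e with neighbours (toℕ i) (toℕ<n i) _ e
        ... | j′ , j′< , same , rel = subst (Rel (toℕ i)) (dist j′< (toℕ<n j) same) rel

      consecutive-adjacent : ∀ {i j} → Consecutive i j → x i ~ x j
      consecutive-adjacent {i} (inj₁ refl) = edge i
      consecutive-adjacent {j = j} (inj₂ refl) = ~-sym (edge j)

      module Path (end : ¬ TwoNeighbours s) where
        revisit-k : toℕ m ≡ k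
        revisit-k with revisit-index
        ... | inj₂ m≡k = m≡k
        ... | inj₁ m≡0 with k ℕ.≟ 0
        ...   | yes k≡0 = trans m≡0 (sym k≡0)
        ...   | no k≢0  = ⊥-elim (end (x 1 , x (suc k) , edge 0 , s~x₁₊ₖ , x₁≢x₁₊ₖ))
          where
          x₁≢x₁₊ₖ : x 1 ≢ x (suc k)
          x₁≢x₁₊ₖ = k≢0 ∘ sym ∘ suc-injective ∘ dist (s≤s (s≤s z≤n)) ≤-refl
          s~x₁₊ₖ : s ~ x (suc k)
          s~x₁₊ₖ = subst (_~ x (suc k)) (sym (trans (cong x (sym m≡0)) revisit)) (~-sym (edge (suc k)))

        dead-end : ∀ y → x (suc k) ~ y → y ≡ x k
        dead-end with turn k
        ... | inj₂ (_ , only)   = only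
        ... | inj₁ (_ , turned) = ⊥-elim (turned (trans (sym revisit) (cong x revisit-k)))

        neighbours : Neighbours Consecutive
        neighbours zero _ y s~y with y ≟ x 1
        ... | yes refl  = 1 , s≤s (s≤s z≤n) , refl , inj₁ refl
        ... | no y≢x₁   = ⊥-elim (end (x 1 , y , edge 0 , s~y , y≢x₁ ∘ sym))
        neighbours (suc i) (s≤s i<1+k) y e with m<1+n⇒m<n∨m≡n i<1+k
        ... | inj₂ refl = k , m<n⇒m<1+n (n<1+n k) , sym (dead-end y e) , inj₂ refl
        ... | inj₁ i<k with interior i<k y e
        ...   | inj₁ y≡xi   = i , inner i<k , sym y≡xi , inj₂ refl
        ...   | inj₂ y≡x2+i = 2 + i , s≤s (s≤s i<k) , sym y≡x2+i , inj₁ refl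

        isPath : Connected (adj X) → IsPathGraph (adj X)
        isPath conn = 2 + k , s≤s z≤n ,
          enumerate conn neighbours consecutive-adjacent (λ i j → ⇔-sym (pathAdj⇔ i j))

      module Cycle (two : ∀ v → TwoNeighbours v) where
        no-dead-end : toℕ m ≢ k
        no-dead-end m≡k with turn k
        ... | inj₁ (_ , turned) = turned (trans (sym revisit) (cong x m≡k))
        ... | inj₂ (_ , only) with two (x (suc k))
        ...   | a , b , e-a , e-b , a≢b = a≢b (trans (only a e-a) (sym (only b e-b)))

        revisit-0 : toℕ m ≡ 0
        revisit-0 = [ id , ⊥-elim ∘ no-dead-end ] revisit-index

        k≢0 : k ≢ 0
        k≢0 k≡0 = no-dead-end (trans revisit-0 (sym k≡0))

        closing : x 0 ~ x (suc k)
        closing = subst (_~ x (suc k)) (sym (trans (cong x (sym revisit-0)) revisit)) (~-sym (edge (suc k)))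

        CycleStep : ℕ → ℕ → Set
        CycleStep i j = Consecutive i j ⊎ (i ≡ 0 × j ≡ suc k) ⊎ (j ≡ 0 × i ≡ suc k)

        neighbours : Neighbours CycleStep
        neighbours zero _ y e with deg≤2 s (edge 0) closing e
        ... | inj₁ x₁≡x₁₊ₖ        = ⊥-elim (k≢0 (sym (suc-injective (dist (s≤s (s≤s z≤n)) ≤-refl x₁≡x₁₊ₖ))))
        ... | inj₂ (inj₁ x₁≡y)    = 1 , s≤s (s≤s z≤n) , x₁≡y , inj₁ (inj₁ refl)
        ... | inj₂ (inj₂ x₁₊ₖ≡y)  = suc k , ≤-refl , x₁₊ₖ≡y , inj₂ (inj₁ (refl , refl))
        neighbours (suc i) (s≤s i<1+k) y e with m<1+n⇒m<n∨m≡n i<1+k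
        ... | inj₁ i<k with interior i<k y e
        ...   | inj₁ y≡xi   = i , inner i<k , sym y≡xi , inj₁ (inj₂ refl)
        ...   | inj₂ y≡x2+i = 2 + i , s≤s (s≤s i<k) , sym y≡x2+i , inj₁ (inj₁ refl)
        neighbours (suc i) (s≤s i<1+k) y e | inj₂ refl with deg≤2 (x (suc k)) (~-sym (edge k)) (~-sym closing) e
        ... | inj₁ xₖ≡x₀          = ⊥-elim (k≢0 (dist (m<n⇒m<1+n (n<1+n k)) (s≤s z≤n) xₖ≡x₀))
        ... | inj₂ (inj₁ xₖ≡y)    = k , m<n⇒m<1+n (n<1+n k) , xₖ≡y , inj₁ (inj₂ refl)
        ... | inj₂ (inj₂ x₀≡y)    = 0 , s≤s z≤n , x₀≡y , inj₂ (inj₂ (refl , refl))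

        adjacent : ∀ {i j} → CycleStep i j → x i ~ x j
        adjacent (inj₁ step)                = consecutive-adjacent step
        adjacent (inj₂ (inj₁ (refl , refl))) = closing
        adjacent (inj₂ (inj₂ (refl , refl))) = ~-sym closing

        isCycle : Connected (adj X) → IsCycleGraph (adj X)
        isCycle conn = 2 + k , s≤s (s≤s (n≢0⇒n>0 k≢0)) , enumerate conn neighbours adjacent
          (λ i j → ⇔-sym (⇔-trans (cycleAdj⇔ i j) (pathAdj⇔ i j ⊎-⇔ ⇔-refl)))

  path-from-end : Connected (adj X) → ∀ s → ¬ TwoNeighbours s → IsPathGraph (adj X)
  path-from-end conn s end with any? (λ a → T? (adj X s a))
  ... | no isolated = 1 , s≤s z≤n , isomorphic-by-enumeration {S = pathAdj 1} conn (λ _ → s) Fin.zero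
        (λ { {Fin.zero} {Fin.zero} _ → refl }) (λ _ v s~v → ⊥-elim (isolated (v , s~v)))
        (λ { Fin.zero Fin.zero → mk⇔ (⊥-elim ∘ ~-irrefl) (λ ()) })
  ... | yes (_ , s~a) with Trail.first-loop s s~a
  ...   | k , first , m , revisit = Trail.Loop.Path.isPath s s~a k first m revisit end conn

  cycle-without-end : Connected (adj X) → (∀ v → TwoNeighbours v) → IsCycleGraph (adj X)
  cycle-without-end conn@(r , _) two with two r
  ... | _ , _ , r~a , _ with Trail.first-loop r r~a
  ...   | k , first , m , revisit = Trail.Loop.Cycle.isCycle r r~a k first m revisit two conn

  path-or-cycle : Connected (adj X) → IsPathGraph (adj X) ⊎ IsCycleGraph (adj X)
  path-or-cycle conn with any? (¬? ∘ twoNeighbours?)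
  ... | yes (s , end) = inj₁ (path-from-end conn s end)
  ... | no ¬end       = inj₂ (cycle-without-end conn λ v → decidable-stable (twoNeighbours? v) (¬end ∘ (v ,_)))

γ-connected⇒claw : ∀ {n} (X : Graph n) → Connected (adj X) → Connected (γ X) → Claw X
γ-connected⇒claw X conn γ-conn with claw-or-maxDegree≤2 X
... | inj₁ claw  = claw
... | inj₂ deg≤2 = ⊥-elim ([ path⇒γ-disconnected X , cycle⇒γ-disconnected X ]′
                             (MaxDegreeTwo.path-or-cycle X deg≤2 conn) γ-conn)

γ-connected⇔neither-cycle-nor-path : ∀ {n} (X : Graph n) → Connected (adj X) →
  Connected (γ X) ⇔ (¬ IsCycleGraph (adj X) × ¬ IsPathGraph (adj X))
γ-connected⇔neither-cycle-nor-path X conn = mk⇔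
  (λ γ-conn → (λ cycle → cycle⇒γ-disconnected X cycle γ-conn) , (λ path → path⇒γ-disconnected X path γ-conn))
  neither⇒γ-connected
  where
  neither⇒γ-connected : ¬ IsCycleGraph (adj X) × ¬ IsPathGraph (adj X) → Connected (γ X)
  neither⇒γ-connected (¬cycle , ¬path) with claw-or-maxDegree≤2 X
  ... | inj₁ claw  = claw⇒γ-connected X conn claw
  ... | inj₂ deg≤2 = ⊥-elim ([ ¬path , ¬cycle ] (MaxDegreeTwo.path-or-cycle X deg≤2 conn))

-- (1) When γ(X) is a cycle

-- Each arc has at most two γ-neighbours: an arc (a , z) forbids a fourth neighbour of z, and an arc
-- (z , a) forbids a second neighbour of a.
module StarFromClaw {n : ℕ} (X : Graph n) (conn : Connected (adj X)) (γ-deg≤2 : MaxDegree≤2 (γ X))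
                    (claw : Claw X) where
  open Arcs X
  open Claw claw renaming (centre to z; centre~a to z~a; centre~b to z~b; centre~c to z~c)

  no-three : ∀ e f₁ f₂ f₃ → e ⇝ f₁ → e ⇝ f₂ → e ⇝ f₃ → f₁ ≢ f₂ → f₁ ≢ f₃ → f₂ ≢ f₃ → ⊥
  no-three e f₁ f₂ f₃ e₁ e₂ e₃ f₁≢f₂ f₁≢f₃ f₂≢f₃ =
    [ f₁≢f₂ , [ f₁≢f₃ , f₂≢f₃ ]′ ]′ (γ-deg≤2 e e₁ e₂ e₃)

  centre-neighbour : ∀ d → z ~ d → d ≡ a ⊎ d ≡ b ⊎ d ≡ c
  centre-neighbour d z~d with d ≟ a | d ≟ b | d ≟ c
  ... | yes d≡a | _       | _       = inj₁ d≡a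
  ... | no _    | yes d≡b | _       = inj₂ (inj₁ d≡b)
  ... | no _    | no _    | yes d≡c = inj₂ (inj₂ d≡c)
  ... | no d≢a  | no d≢b  | no d≢c  = ⊥-elim (no-three (arc a z (~-sym z~a)) (arc z b z~b) (arc z c z~c) (arc z d z~d)
    (⇝-continue (~-sym z~a) z~b (a≢b ∘ sym)) (⇝-continue (~-sym z~a) z~c (a≢c ∘ sym))
    (⇝-continue (~-sym z~a) z~d d≢a) (tgt≢⇒≢ b≢c) (tgt≢⇒≢ (d≢b ∘ sym)) (tgt≢⇒≢ (d≢c ∘ sym)))

  leaf-neighbour : ∀ {ℓ ℓ′ ℓ″} → z ~ ℓ → z ~ ℓ′ → z ~ ℓ″ → ℓ ≢ ℓ′ → ℓ ≢ ℓ″ → ℓ′ ≢ ℓ″ →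
                   ∀ t → ℓ ~ t → t ≡ z
  leaf-neighbour z~ℓ z~ℓ′ z~ℓ″ ℓ≢ℓ′ ℓ≢ℓ″ ℓ′≢ℓ″ t ℓ~t with t ≟ z
  ... | yes t≡z = t≡z
  ... | no t≢z  = ⊥-elim (no-three (arc _ _ z~ℓ) (arc _ t ℓ~t) (arc _ z (~-sym z~ℓ′)) (arc _ z (~-sym z~ℓ″))
    (⇝-continue z~ℓ ℓ~t t≢z) (⇝-precede z~ℓ (~-sym z~ℓ′) (ℓ≢ℓ′ ∘ sym)) (⇝-precede z~ℓ (~-sym z~ℓ″) (ℓ≢ℓ″ ∘ sym))
    (src≢⇒≢ ℓ≢ℓ′) (src≢⇒≢ ℓ≢ℓ″) (src≢⇒≢ ℓ′≢ℓ″))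

  leaf : Fin 3 → Fin n
  leaf 0F = a
  leaf 1F = b
  leaf 2F = c

  centre~leaf : ∀ i → z ~ leaf i
  centre~leaf 0F = z~a
  centre~leaf 1F = z~b
  centre~leaf 2F = z~c

  leaf-only-centre : ∀ i t → leaf i ~ t → t ≡ z
  leaf-only-centre 0F = leaf-neighbour z~a z~b z~c a≢b a≢c b≢c
  leaf-only-centre 1F = leaf-neighbour z~b z~a z~c (a≢b ∘ sym) b≢c a≢c
  leaf-only-centre 2F = leaf-neighbour z~c z~a z~b (a≢c ∘ sym) (b≢c ∘ sym) a≢b

  leaf-injective : ∀ {i j} → leaf i ≡ leaf j → i ≡ j
  leaf-injective {0F} {0F} _ = refl
  leaf-injective {1F} {1F} _ = refl
  leaf-injective {2F} {2F} _ = refl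
  leaf-injective {0F} {1F} a≡b = ⊥-elim (a≢b a≡b)
  leaf-injective {0F} {2F} a≡c = ⊥-elim (a≢c a≡c)
  leaf-injective {1F} {0F} b≡a = ⊥-elim (a≢b (sym b≡a))
  leaf-injective {1F} {2F} b≡c = ⊥-elim (b≢c b≡c)
  leaf-injective {2F} {0F} c≡a = ⊥-elim (a≢c (sym c≡a))
  leaf-injective {2F} {1F} c≡b = ⊥-elim (b≢c (sym c≡b))

  vertex : Fin 4 → Fin n
  vertex 0F        = z
  vertex (Fin.suc i) = leaf i

  vertex-injective : ∀ {i j} → vertex i ≡ vertex j → i ≡ j
  vertex-injective {0F}        {0F}        _ = refl
  vertex-injective {0F}        {Fin.suc j} z≡ℓ = ⊥-elim (~⇒≢ (centre~leaf j) z≡ℓ)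
  vertex-injective {Fin.suc i} {0F}        ℓ≡z = ⊥-elim (~⇒≢ (centre~leaf i) (sym ℓ≡z))
  vertex-injective {Fin.suc i} {Fin.suc j} ℓ≡ℓ = cong Fin.suc (leaf-injective ℓ≡ℓ)

  closed : ∀ i v → vertex i ~ v → Σ (Fin 4) λ j → vertex j ≡ v
  closed 0F v z~v with centre-neighbour v z~v
  ... | inj₁ v≡a        = 1F , sym v≡a
  ... | inj₂ (inj₁ v≡b) = 2F , sym v≡b
  ... | inj₂ (inj₂ v≡c) = 3F , sym v≡c
  closed (Fin.suc i) v ℓ~v = 0F , sym (leaf-only-centre i v ℓ~v)

  adjacency : ∀ i j → vertex i ~ vertex j ⇔ T (starAdj i j)
  adjacency 0F          0F          = mk⇔ (⊥-elim ∘ ~-irrefl) λ ()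
  adjacency 0F          (Fin.suc j) = mk⇔ (λ _ → tt) (λ _ → centre~leaf j)
  adjacency (Fin.suc i) 0F          = mk⇔ (λ _ → tt) (λ _ → ~-sym (centre~leaf i))
  adjacency (Fin.suc i) (Fin.suc j) = mk⇔ (λ ℓ~ℓ → ⊥-elim (~⇒≢ (centre~leaf j) (sym (leaf-only-centre i _ ℓ~ℓ)))) λ ()

  isStar : IsK13 (adj X)
  isStar = isomorphic-by-enumeration conn vertex 0F vertex-injective closed adjacency

γ-cycle⇒star : ∀ {n} (X : Graph n) → Connected (adj X) → IsCycleGraph (γ X) → IsK13 (adj X)
γ-cycle⇒star X conn γ-cycle@(k , 3≤k , iso) =
  StarFromClaw.isStar X conn γ-maxDegree≤2 (γ-connected⇒claw X conn γ-connected)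
  where
  γ-maxDegree≤2 : MaxDegree≤2 (γ X)
  γ-maxDegree≤2 = LinearOrientation.maxDegree≤2 (pullback iso (cycleAdj-linear k 3≤k))
  γ-connected : Connected (γ X)
  γ-connected = cycle-connected (λ {a} {b} → Arcs.⇝-sym X {a} {b}) γ-cycle

-- (2) Cut edges

module CutEdges {n : ℕ} (X : Graph n) where
  open Arcs X
  open Degree X

  pendant⇒γ-cut-edge : HasPendantNextToDeg2 X → HasCutEdge (γ X)
  pendant⇒γ-cut-edge (u , v , u~v , deg-u , deg-v) with degree≡2⇒other-neighbour deg-v (~-sym u~v)
  ... | w , v~w , w≢u , v-neighbour = a , b , ⇝-precede (~-sym u~v) (~-sym v~w) w≢u , λ r → isolated r refl
    where
    a b : Arc
    a = arc v u (~-sym u~v)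
    b = arc w v (~-sym v~w)
    isolated : ∀ {c} → ReachAvoiding (γ X) a b a c → c ≢ b
    isolated ε a≡b = ~⇒≢ v~w (cong src a≡b)
    isolated (_◅_ {j = arc x y q} (step , avoid) _) _ with ⇝-cases {p = ~-sym u~v} {q = q} step
    ... | inj₁ (refl , y≢v) = y≢v (degree≡1⇒unique-neighbour deg-u u~v y q)
    ... | inj₂ (refl , x≢u) = [ x≢u , (λ x≡w → avoid (inj₁ (refl , arc-cong x≡w refl))) ]′ (v-neighbour x (~-sym q))

  module Bridge (γ-conn : Connected (γ X)) (no-pendant : ¬ HasPendantNextToDeg2 X)
                {u v w} (u~v : u ~ v) (v~w : v ~ w) (w≢u : w ≢ u)
                (cut : ¬ ReachAvoiding (γ X) (arc u v u~v) (arc v w v~w) (arc u v u~v) (arc v w v~w)) where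
    open ⊕-Sum
    e f : Arc
    e = arc u v u~v
    f = arc v w v~w

    Crossing : Arc → Arc → Set
    Crossing g h = (g ≡ e × h ≡ f) ⊎ (g ≡ f × h ≡ e)

    infix 4 _—_
    _—_ : Arc → Arc → Set
    _—_ = ReachAvoiding (γ X) e f

    from-off-bridge : ∀ {g h} → g ≢ e → g ≢ f → ¬ Crossing g h
    from-off-bridge g≢e g≢f = [ g≢e ∘ proj₁ , g≢f ∘ proj₁ ]′

    to-off-bridge : ∀ {g h} → h ≢ e → h ≢ f → ¬ Crossing g h
    to-off-bridge h≢e h≢f = [ h≢f ∘ proj₂ , h≢e ∘ proj₂ ]′

    —-sym : ∀ {g h} → g — h → h — g
    —-sym = avoiding-reverse (λ {a} {b} → ⇝-sym {a} {b})

    step : ∀ g h → g ⇝ h → ¬ Crossing g h → g — h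
    step _ _ g⇝h no-crossing = (g⇝h , no-crossing) ◅ ε

    v-neighbour : ∀ y → v ~ y → y ≡ u ⊎ y ≡ w
    v-neighbour y v~y with y ≟ u | y ≟ w
    ... | yes y≡u | _       = inj₁ y≡u
    ... | no _    | yes y≡w = inj₂ y≡w
    ... | no y≢u  | no y≢w  = ⊥-elim (cut detour)
      where
      u≢v : u ≢ v
      u≢v = ~⇒≢ u~v
      v≢w : v ≢ w
      v≢w = ~⇒≢ v~w
      -- Around v through the third neighbour y: (u,v) (v,y) (w,v) (v,u) (y,v) (v,w).
      detour : e — f
      detour =
            step e (arc v y v~y) (⇝-continue u~v v~y y≢u)
                 (to-off-bridge (src≢⇒≢ (u≢v ∘ sym)) (tgt≢⇒≢ y≢w))
        ◅◅ step (arc v y v~y) (arc w v (~-sym v~w)) (⇝-precede v~y (~-sym v~w) (y≢w ∘ sym))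
                 (from-off-bridge (src≢⇒≢ (u≢v ∘ sym)) (tgt≢⇒≢ y≢w))
        ◅◅ step (arc w v (~-sym v~w)) (arc v u (~-sym u~v)) (⇝-continue (~-sym v~w) (~-sym u~v) (w≢u ∘ sym))
                 (from-off-bridge (src≢⇒≢ w≢u) (src≢⇒≢ (v≢w ∘ sym)))
        ◅◅ step (arc v u (~-sym u~v)) (arc y v (~-sym v~y)) (⇝-precede (~-sym u~v) (~-sym v~y) y≢u)
                 (from-off-bridge (src≢⇒≢ (u≢v ∘ sym)) (tgt≢⇒≢ (w≢u ∘ sym)))
        ◅◅ step (arc y v (~-sym v~y)) f (⇝-continue (~-sym v~y) v~w (y≢w ∘ sym))
                 (from-off-bridge (src≢⇒≢ y≢u) (src≢⇒≢ (~⇒≢ v~y ∘ sym)))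

    crossing? : ∀ g h → Dec (Crossing g h)
    crossing? g h = (g ≟ᵃ e ×-dec h ≟ᵃ f) ⊎-dec (g ≟ᵃ f ×-dec h ≟ᵃ e)

    -- Cutting a walk at its first crossing of the bridge.
    toward-bridge : ∀ {g} → ArcWalk g e → g — e ⊎ g — f
    toward-bridge ε = inj₁ ε
    toward-bridge {g} (_◅_ {j = h} g⇝h rest) with crossing? g h
    ... | yes (inj₁ (refl , _)) = inj₁ ε
    ... | yes (inj₂ (refl , _)) = inj₂ ε
    ... | no no-crossing = Data.Sum.map ((g⇝h , no-crossing) ◅_) ((g⇝h , no-crossing) ◅_) (toward-bridge rest)

    sided : ∀ g → Σ Bool λ s → if s then g — f else g — e
    sided g with toward-bridge (proj₂ γ-conn g e)
    ... | inj₁ g—e = false , g—e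
    ... | inj₂ g—f = true  , g—f

    side : Arc → Bool
    side = proj₁ ∘ sided

    side-step : ∀ {g h} → g ⇝ h → ¬ Crossing g h → side g ≡ side h
    side-step {g} {h} g⇝h no-crossing with sided g | sided h
    ... | false , _   | false , _   = refl
    ... | true  , _   | true  , _   = refl
    ... | false , g—e | true  , h—f = ⊥-elim (cut (—-sym g—e ◅◅ step g h g⇝h no-crossing ◅◅ h—f))
    ... | true  , g—f | false , h—e = ⊥-elim (cut (—-sym h—e ◅◅ —-sym (step g h g⇝h no-crossing) ◅◅ g—f))

    side-e : side e ≡ false
    side-e with sided e
    ... | false , _   = refl
    ... | true  , e—f = ⊥-elim (cut e—f)

    side-f : side f ≡ true
    side-f with sided f
    ... | true  , _   = refl
    ... | false , f—e = ⊥-elim (cut (—-sym f—e))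

    through : ∀ {p x y} (x~p : x ~ p) (p~y : p ~ y) → y ≢ x → p ≢ v →
              side (arc x p x~p) ≡ side (arc p y p~y)
    through x~p p~y y≢x p≢v = side-step (⇝-continue x~p p~y y≢x)
      [ p≢v ∘ cong tgt ∘ proj₁ , (λ (g≡f , h≡e) → w≢u (trans (sym (cong tgt g≡f)) (cong src h≡e))) ]′

    balanced : ∀ {q s s′ t} → q ≢ v → q ~ s → q ~ s′ → (q~t : q ~ t) → s ≢ t → s′ ≢ t → s ≢ s′ →
               side (arc t q (~-sym q~t)) ≡ side (arc q t q~t)
    balanced q≢v q~s q~s′ q~t s≢t s′≢t s≢s′ = begin
      side (arc _ _ (~-sym q~t))   ≡⟨ through (~-sym q~t) q~s s≢t q≢v ⟩
      side (arc _ _ q~s)           ≡⟨ through (~-sym q~s′) q~s s≢s′ q≢v ⟨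
      side (arc _ _ (~-sym q~s′))  ≡⟨ through (~-sym q~s′) q~t (s′≢t ∘ sym) q≢v ⟩
      side (arc _ _ q~t)           ∎
      where open ≡-Reasoning

    claw-balanced : ∀ {q a b c} → q ≢ v → q ~ a → q ~ b → q ~ c → a ≢ b → a ≢ c → b ≢ c →
                    ∀ {t} (q~t : q ~ t) → side (arc t q (~-sym q~t)) ≡ side (arc q t q~t)
    claw-balanced {a = a} {b} q≢v q~a q~b q~c a≢b a≢c b≢c {t} q~t with t ≟ a | t ≟ b
    ... | yes refl | _        = balanced q≢v q~b q~c q~t (a≢b ∘ sym) (a≢c ∘ sym) b≢c
    ... | no _     | yes refl = balanced q≢v q~a q~c q~t a≢b (b≢c ∘ sym) a≢c
    ... | no t≢a   | no t≢b   = balanced q≢v q~a q~b q~t (t≢a ∘ sym) (t≢b ∘ sym) a≢b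

    v-no-claw : ∀ {a b c} → v ~ a → v ~ b → v ~ c → a ≢ b → a ≢ c → b ≢ c → ⊥
    v-no-claw {a} {b} {c} v~a v~b v~c a≢b a≢c b≢c with v-neighbour a v~a | v-neighbour b v~b | v-neighbour c v~c
    ... | inj₁ refl | inj₁ refl | _         = a≢b refl
    ... | inj₂ refl | inj₂ refl | _         = a≢b refl
    ... | inj₁ refl | inj₂ refl | inj₁ refl = a≢c refl
    ... | inj₁ refl | inj₂ refl | inj₂ refl = b≢c refl
    ... | inj₂ refl | inj₁ refl | inj₁ refl = b≢c refl
    ... | inj₂ refl | inj₁ refl | inj₂ refl = a≢c refl

    -- The two arcs of an edge whose ends both have degree one would be isolated in γ(X).
    isolated-edge : ∀ {p q t} → p ~ q → (∀ x → p ~ x → x ≡ q) → (∀ x → q ~ x → x ≡ t) → ⊥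
    isolated-edge {p} {q} p~q p-only q-only = stuck (proj₂ γ-conn (arc p q p~q) e) refl
      where
      stuck : ∀ {g} → ArcWalk g e → g ≡ arc p q p~q → ⊥
      stuck ε e≡pq = w≢u (trans (q-only w (subst (_~ w) (cong tgt e≡pq) v~w))
                           (sym (q-only u (subst (_~ u) (cong tgt e≡pq) (~-sym u~v)))))
      stuck (_◅_ {j = arc x y r} step _) refl with ⇝-cases {p = p~q} {q = r} step
      ... | inj₁ (refl , y≢p) = y≢p (trans (q-only y r) (sym (q-only p (~-sym p~q))))
      ... | inj₂ (refl , x≢q) = x≢q (p-only x (~-sym r))

    Side : Fin n → Fin n → Bool
    Side p q with T? (adj X p q)
    ... | yes p~q = side (arc p q p~q)
    ... | no _    = false

    Side-edge : ∀ {p q} (p~q : p ~ q) → Side p q ≡ side (arc p q p~q)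
    Side-edge {p} {q} p~q with T? (adj X p q)
    ... | yes _    = cong side (arc-cong refl refl)
    ... | no ¬p~q  = ⊥-elim (¬p~q p~q)

    Side-non-edge : ∀ {p q} → ¬ p ~ q → Side p q ≡ false
    Side-non-edge {p} {q} ¬p~q with T? (adj X p q)
    ... | yes p~q = ⊥-elim (¬p~q p~q)
    ... | no _    = refl

    flips : Fin n → Fin n → Bool
    flips p q = Side p q xor Side q p

    flips-non-edge : ∀ {p q} → ¬ p ~ q → flips p q ≡ false
    flips-non-edge ¬p~q = cong₂ _xor_ (Side-non-edge ¬p~q) (Side-non-edge (¬p~q ∘ ~-sym))

    flips-balanced : ∀ {p q} (p~q : p ~ q) → side (arc q p (~-sym p~q)) ≡ side (arc p q p~q) → flips p q ≡ false
    flips-balanced p~q same = trans (cong₂ _xor_ (Side-edge p~q) (trans (Side-edge (~-sym p~q)) same))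
                                    (xor-same (side (arc _ _ p~q)))

    flips-pendant : ∀ {p q} → p ≢ v → p ~ q → (∀ x → p ~ x → x ≡ q) → flips p q ≡ false
    flips-pendant {p} {q} p≢v p~q p-only with supportSize (adj X q)
    ... | size0 none = ⊥-elim (none p (~-sym p~q))
    ... | size1 _ q-only = ⊥-elim (isolated-edge p~q p-only q-only)
    ... | size2 a≢b q~a q~b q-only = ⊥-elim (no-pendant (p , q , p~q , degree-size1 p~q p-only , degree-size2 a≢b q~a q~b q-only))
    ... | size≥3 a≢b a≢c b≢c q~a q~b q~c = flips-balanced p~q
          (trans (sym (claw-balanced q≢v q~a q~b q~c a≢b a≢c b≢c (~-sym p~q))) (cong side (arc-cong refl refl)))
      where
      q≢v : q ≢ v
      q≢v refl = v-no-claw q~a q~b q~c a≢b a≢c b≢c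

    flips-degree-two : ∀ {p q₁ q₂} → p ≢ v → (p~q₁ : p ~ q₁) (p~q₂ : p ~ q₂) → q₁ ≢ q₂ →
                       flips p q₁ ≡ flips p q₂
    flips-degree-two p≢v p~q₁ p~q₂ q₁≢q₂ = begin
      Side _ _ xor Side _ _  ≡⟨ cong₂ _xor_ (Side-edge p~q₁) (trans (Side-edge (~-sym p~q₁)) in₁≡out₂) ⟩
      out₁ xor out₂          ≡⟨ xor-comm out₁ out₂ ⟩
      out₂ xor out₁          ≡⟨ cong₂ _xor_ (Side-edge p~q₂) (trans (Side-edge (~-sym p~q₂)) in₂≡out₁) ⟨
      Side _ _ xor Side _ _  ∎
      where
      open ≡-Reasoning
      out₁ out₂ : Bool
      out₁ = side (arc _ _ p~q₁)
      out₂ = side (arc _ _ p~q₂)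
      in₁≡out₂ : side (arc _ _ (~-sym p~q₁)) ≡ out₂
      in₁≡out₂ = through (~-sym p~q₁) p~q₂ (q₁≢q₂ ∘ sym) p≢v
      in₂≡out₁ : side (arc _ _ (~-sym p~q₂)) ≡ out₁
      in₂≡out₁ = through (~-sym p~q₂) p~q₁ q₁≢q₂ p≢v

    flips-sum-away : ∀ {p} → p ≢ v → sum (flips p) ≡ false
    flips-sum-away {p} p≢v with supportSize (adj X p)
    ... | size0 none = sum-zero (flips p) (flips-non-edge ∘ none)
    ... | size1 {q} p~q only = trans (sum-single (flips p) q (λ x x≢q → flips-non-edge (x≢q ∘ only x)))
                                     (flips-pendant p≢v p~q only)
    ... | size2 {q₁} {q₂} q₁≢q₂ p~q₁ p~q₂ only = begin
      sum (flips p)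
        ≡⟨ sum-pair (flips p) q₁≢q₂ (λ x x≢q₁ x≢q₂ → flips-non-edge ([ x≢q₁ , x≢q₂ ]′ ∘ only x)) ⟩
      flips p q₁ xor flips p q₂
        ≡⟨ cong (_xor flips p q₂) (flips-degree-two p≢v p~q₁ p~q₂ q₁≢q₂) ⟩
      flips p q₂ xor flips p q₂
        ≡⟨ xor-same (flips p q₂) ⟩
      false ∎
      where open ≡-Reasoning
    ... | size≥3 a≢b a≢c b≢c p~a p~b p~c = sum-zero (flips p) flips-claw
      where
      flips-claw : ∀ q → flips p q ≡ false
      flips-claw q = [ (λ p~q → flips-balanced p~q (claw-balanced p≢v p~a p~b p~c a≢b a≢c b≢c p~q)) ,
                       flips-non-edge ]′ (edge-or-not p q)

    flips-sum-v : sum (flips v) ≡ true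
    flips-sum-v = begin
      sum (flips v)
        ≡⟨ sum-pair (flips v) (w≢u ∘ sym) (λ x x≢u x≢w → flips-non-edge ([ x≢u , x≢w ]′ ∘ v-neighbour x)) ⟩
      flips v u xor flips v w
        ≡⟨ cong₂ _xor_ (cong₂ _xor_ (Side-edge (~-sym u~v)) (trans (Side-edge u~v) side-e))
                       (cong₂ _xor_ (trans (Side-edge v~w) side-f) (trans (Side-edge (~-sym v~w)) wv≡vu)) ⟩
      (side vu xor false) xor (true xor side vu)
        ≡⟨ odd (side vu) ⟩
      true ∎
      where
      open ≡-Reasoning
      vu : Arc
      vu = arc v u (~-sym u~v)
      wv≡vu : side (arc w v (~-sym v~w)) ≡ side vu
      wv≡vu = side-step (⇝-continue (~-sym v~w) (~-sym u~v) (w≢u ∘ sym))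
                        (from-off-bridge (src≢⇒≢ w≢u) (src≢⇒≢ (~⇒≢ v~w ∘ sym)))
      odd : ∀ s → (s xor false) xor (true xor s) ≡ true
      odd true  = refl
      odd false = refl

    -- Summed over all pairs (p , q) the flips cancel, yet only the terms at v survive.
    contradiction : ⊥
    contradiction = false≢true (begin
      false                             ≡⟨ sum-symmetric flips (λ p q → xor-comm (Side p q) (Side q p))
                                                               (λ p → xor-same (Side p p)) ⟨
      sum (λ p → sum (flips p))         ≡⟨ sum-single (λ p → sum (flips p)) v (λ p → flips-sum-away) ⟩
      sum (flips v)                     ≡⟨ flips-sum-v ⟩
      true                              ∎)
      where
      open ≡-Reasoning
      false≢true : false ≢ true
      false≢true ()

  pendant? : Dec (HasPendantNextToDeg2 X)
  pendant? = any? λ u → any? λ v → T? (adj X u v) ×-dec degree X u ℕ.≟ 1 ×-dec degree X v ℕ.≟ 2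

  γ-cut-edge⇒pendant : Connected (γ X) → HasCutEdge (γ X) → HasPendantNextToDeg2 X
  γ-cut-edge⇒pendant γ-conn (arc u v u~v , arc x y x~y , adjacent , cut) with pendant?
  ... | yes pendant = pendant
  ... | no no-pendant with ⇝-cases {p = u~v} {q = x~y} adjacent
  ...   | inj₁ (refl , y≢u) = ⊥-elim (Bridge.contradiction γ-conn no-pendant u~v x~y y≢u cut)
  ...   | inj₂ (refl , x≢v) = ⊥-elim (Bridge.contradiction γ-conn no-pendant x~y u~v (x≢v ∘ sym)
                                 (cut ∘ avoiding-reverse (λ {a} {b} → ⇝-sym {a} {b}) ∘ avoiding-swap))

proposition2p5 :
    ((n : ℕ) (X : Graph n) → Connected (adj X) →
       (Connected (γ X) ⇔ (¬ IsCycleGraph (adj X) × ¬ IsPathGraph (adj X)))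
       × (IsCycleGraph (γ X) → IsK13 (adj X)))
    × ((n : ℕ) (X : Graph n) → Connected (γ X) →
       (HasCutEdge (γ X) ⇔ HasPendantNextToDeg2 X))
    × ((n : ℕ) (X : Graph n) → Connected (adj X) →
       (Bipartite (adj X) ⇔ Bipartite (γ X)))
proposition2p5 =
    (λ _ X conn → γ-connected⇔neither-cycle-nor-path X conn , γ-cycle⇒star X conn)
  , (λ _ X γ-conn → mk⇔ (CutEdges.γ-cut-edge⇒pendant X γ-conn) (CutEdges.pendant⇒γ-cut-edge X))
  , (λ _ X conn → mk⇔ (bipartite⇒γ-bipartite X) (γ-bipartite⇒bipartite X conn))
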